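{- Let $\mathcal{I}=(\mathcal{M},\mathcal{D})$ be a Steiner forest instance, $\{s,\bar s\}\in\mathcal{D}$, and $\mathcal{I}'=(\mathcal{M},\mathcal{D}\setminus\{\{s,\bar s\}\})$. Run the timed gluttonous algorithm on both instances; for each stage $i$ let $\mathcal{C}_i$ and $\mathcal{C}'_i$ be the clusterings at the beginning of stage $i$ for $\mathcal{I}$ and $\mathcal{I}'$ respectively, and $\mathcal{M}'_i=\mathcal{M}/\mathcal{C}'_i$. For $i\le\mathrm{level}(s)$, let $C_s,C_{\bar s}$ be the supernodes of $\mathcal{C}_i$ containing $s$ and $\bar s$. Then: (a) If $C_s\neq C_{\bar s}$, the supernodes of $\mathcal{C}'_i$ can be enumerated as $C'_1,\dots,C'_p$ so that for some $0\le a\le b\le p$, $C_s=\{s\}\cup C'_1\cup\dots\cup C'_a$, $C_{\bar s}=\{\bar s\}\cup C'_{a+1}\cup\dots\cup C'_b$, and $\mathcal{C}_i\setminus\{C_s,C_{\bar s}\}=\{C'_{b+1},\dots,C'_p\}$. If $C_s=C_{\bar s}$, they can be enumerated so that for some $0\le b\le p$, $C_s=\{s,\bar s\}\cup C'_1\cup\dots\cup C'_b$ and $\mathcal{C}_i\setminus\{C_s\}=\{C'_{b+1},\dots,C'_p\}$. (b) If $C_s\neq C_{\bar s}$, then $d_{\mathcal{M}'_i}(s,v)\le 2\cdot 2^i$ for every terminal $v\in C_s$, and $d_{\mathcal{M}'_i}(\bar s,v)\le 2\cdot2^i$ for every terminal $v\in C_{\bar s}$. (c) If $C_s=C_{\bar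 s}$, then $d_{\mathcal{M}'_i}(s,\bar s)\le 4\cdot 2^i$.
   Context: A Steiner forest instance $(\mathcal{M},\mathcal{D})$: a finite metric space $\mathcal{M}=(V,d)$ in which all distances are $0$ or at least $1$, and a set $\mathcal{D}$ of pairwise disjoint pairs $\{u,\bar u\}\subseteq V$ with $d(u,\bar u)>0$ (terminals; $\bar u$ is the mate of $u$; terminals carry distinct indices). A clustering is a partition of the terminals into supernodes. For a clustering $\mathcal{C}$, $G_{\mathcal{C}}$ is the complete graph on $V$ with edge $\{x,y\}$ of length $0$ if $x,y$ are terminals in a common supernode and $d(x,y)$ otherwise; $\mathcal{M}/\mathcal{C}$ denotes the shortest-path metric $d_{\mathcal{M}/\mathcal{C}}$ of $G_{\mathcal{C}}$ (on all of $V$), and $d_{\mathcal{M}/\mathcal{C}}(S_1,S_2)=\min_{u\in S_1,v\in S_2}d_{\mathcal{M}/\mathcal{C}}(u,v)$. Timed gluttonous algorithm: let $\mathrm{level}(s)=\lceil\log_2 d(s,\bar s)\rceil$; the leader of a supernode $S$ is the terminal of $S$ maximizing $d(s,\bar s)$ (ties: smallest index). Start with singletons and $E'=\emptyset$. For stages $i=0,1,2,\dots$: a supernode is active during stage $i$ if its leader has level $\ge i$; while there exist two distinct active supernodes $S',S''$ of the current clustering $\mathcal{C}$ with $d_{\mathcal{M}/\mathcal{C}}(S',S'')\le 2^{i+1}$, pick any such pair, add to $E'$ the inter-supernode edges of a path in $G_{\mathcal{C}}$ between them of length at most $2^{i+1}$, and replace $S',S''$ by $S'\cup S''$. Stop once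 no terminal has level $\ge i$; output a maximal acyclic subgraph of $E'$.
   Formalization: The distances of the metric space $\mathcal{M}$ are rational. -}

module Defs where

open import Data.Nat as ℕ using (ℕ; zero; suc; _^_)
open import Data.Bool using (Bool; true; false; if_then_else_; _∧_; _∨_)
open import Data.Fin using (Fin; toℕ; _≟_)
open import Data.Fin.Subset using (Subset; _∈_; _∪_; ⁅_⁆; ⋃)
open import Data.Vec using (lookup)
open import Data.List using (List; []; _∷_; concatMap)
open import Data.Bool.ListAction using (any)
open import Data.List.Membership.Propositional using () renaming (_∈_ to _∈ₗ_)
open import Data.List.Relation.Binary.Permutation.Propositional using (_↭_)
open import Data.List.Relation.Unary.Unique.Propositional using (Unique)
open import Data.List.Relation.Unary.All using (All)
open import Data.Rational using (ℚ; 0ℚ; 1ℚ; _+_; _≤_; _<_; _/_)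
open import Data.Integer using (+_)
open import Data.Product using (Σ; ∃; ∃-syntax; _×_; _,_; proj₁; proj₂)
open import Data.Sum using (_⊎_)
open import Relation.Nullary using (¬_; does)
open import Relation.Binary.PropositionalEquality using (_≡_; _≢_)
open import Relation.Binary.Construct.Closure.ReflexiveTransitive using (Star)

record Metric (n : ℕ) : Set where
  field
    d        : Fin n → Fin n → ℚ
    d-refl   : ∀ x → d x x ≡ 0ℚ
    d-ident  : ∀ x y → d x y ≡ 0ℚ → x ≡ y
    d-sym    : ∀ x y → d x y ≡ d y x
    d-tri    : ∀ x y z → d x z ≤ d x y + d y z
    d-gap    : ∀ x y → d x y ≡ 0ℚ ⊎ 1ℚ ≤ d x y

pow2 : ℕ → ℚ
pow2 k = + (2 ^ k) / 1

-- level(q) = ⌈log₂ q⌉ (for q ≥ 1): the least k with q ≤ 2^k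
Level : ℚ → ℕ → Set
Level q k = q ≤ pow2 k × (∀ j → q ≤ pow2 j → k ℕ.≤ j)

endpoints : ∀ {n} → List (Fin n × Fin n) → List (Fin n)
endpoints = concatMap (λ p → proj₁ p ∷ proj₂ p ∷ [])

ValidInstance : ∀ {n} → Metric n → List (Fin n × Fin n) → Set
ValidInstance M D =
  All (λ p → 0ℚ < Metric.d M (proj₁ p) (proj₂ p)) D × Unique (endpoints D)

Clustering : ℕ → Set
Clustering n = List (Subset n)

sameB : ∀ {n} → Clustering n → Fin n → Fin n → Bool
sameB C x y = any (λ S → lookup S x ∧ lookup S y) C

-- Contracted metric M/C: shortest paths in G_C.
module Contracted {n : ℕ} (M : Metric n) (C : Clustering n) where
  open Metric M

  wt : Fin n → Fin n → ℚ
  wt x y = if sameB C x y then 0ℚ else d x y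

  walkLen : Fin n → List (Fin n) → Fin n → ℚ
  walkLen x []       y = wt x y
  walkLen x (v ∷ vs) y = wt x v + walkLen v vs y

  -- d_{M/C}(x,y) ≤ r  (the shortest-path distance is attained by a walk)
  DistLe : Fin n → Fin n → ℚ → Set
  DistLe x y r = ∃[ vs ] walkLen x vs y ≤ r

  SetDistLe : Subset n → Subset n → ℚ → Set
  SetDistLe S₁ S₂ r = ∃[ u ] ∃[ v ] (u ∈ S₁ × v ∈ S₂ × DistLe u v r)

module Gluttonous {n : ℕ} (M : Metric n) (D : List (Fin n × Fin n)) where
  open Metric M

  -- d(t, t̄) for a terminal t (0 for non-terminals)
  mateDist : Fin n → ℚ
  mateDist t = go D
    where
    go : List (Fin n × Fin n) → ℚ
    go [] = 0ℚ
    go ((u , v) ∷ rest) =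
      if does (t ≟ u) ∨ does (t ≟ v) then d u v else go rest

  IsLeader : Subset n → Fin n → Set
  IsLeader S t = t ∈ S × (∀ t' → t' ∈ S →
    mateDist t' < mateDist t ⊎ (mateDist t' ≡ mateDist t × toℕ t ℕ.≤ toℕ t'))

  Active : ℕ → Subset n → Set
  Active i S = ∃[ t ] (IsLeader S t × ∃[ k ] (Level (mateDist t) k × i ℕ.≤ k))

  singletons : Clustering n
  singletons = concatMap (λ p → ⁅ proj₁ p ⁆ ∷ ⁅ proj₂ p ⁆ ∷ []) D

  CanMerge : ℕ → Clustering n → Set
  CanMerge i C = ∃[ S₁ ] ∃[ S₂ ]
    S₁ ∈ₗ C × S₂ ∈ₗ C
    × S₁ ≢ S₂ × Active i S₁ × Active i S₂
    × Contracted.SetDistLe M C S₁ S₂ (pow2 (suc i))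

  Step : ℕ → Clustering n → Clustering n → Set
  Step i C C'' = ∃[ S₁ ] ∃[ S₂ ] ∃[ rest ]
    (C ↭ S₁ ∷ S₂ ∷ rest) × S₁ ≢ S₂ × Active i S₁ × Active i S₂
    × Contracted.SetDistLe M C S₁ S₂ (pow2 (suc i))
    × C'' ≡ (S₁ ∪ S₂) ∷ rest

  data StartOf : ℕ → Clustering n → Set where
    start : StartOf 0 singletons
    next  : ∀ {i C C'} → StartOf i C → Star (Step i) C C' → ¬ CanMerge i C'
          → StartOf (suc i) C'

-- The runs with and without the pair {s, s̄} are compared stage by stage.
-- Away from s and s̄ both instances have the same terminals and mate
-- distances, so a cluster avoiding s and s̄ is active in one run iff it is in
-- the other.  At the end of a stage neither run can merge, hence no merge of
-- the run without the pair joins two final clusters of the run with it, and a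
-- final cluster of the latter avoiding s and s̄ is a final cluster of the
-- former: this is the decomposition (a).  A merge of the run with the pair is
-- witnessed by a walk of length at most 2^{i+1}; in the other contraction this
-- walk only loses its zero edges inside the clusters of s and s̄.  Cutting it at
-- the last lost edge, and using that distinct active final clusters are more
-- than 2^{i+1} apart, every point merged into the cluster of s stays within
-- 2^{i+1} of s, or within 2·2^{i+1} of s inside an active cluster; this gives
-- (b) at the next stage, and (c) when the clusters of s and s̄ meet.

module Submission where

open import Defs
open import Data.Nat as ℕ using (ℕ; zero; suc; _^_; _∸_; z≤n; s≤s)
import Data.Nat.Properties as ℕ
import Data.Integer as ℤ
import Data.Integer.Properties as ℤ
open import Data.Nat.Coprimality using (Coprime; 1-coprimeTo) renaming (sym to coprime-sym)
open import Data.Rational using (ℚ; 0ℚ; _+_; _/_; mkℚ; *≤*)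
import Data.Rational.Properties as ℚ
open import Data.Product using (∃-syntax; _×_; _,_; proj₁; proj₂; map₁; map₂)
open import Data.Sum using (_⊎_; inj₁; inj₂; [_,_])
open import Data.Empty using (⊥; ⊥-elim)
open import Data.Bool using (Bool; true; false; if_then_else_; _∧_; _∨_)
import Data.Bool.Properties as Bool
open import Data.Fin using (Fin; toℕ; _≟_)
open import Data.Fin.Subset using (Subset; _∈_; _∉_; _⊆_; _∪_; ⁅_⁆; ⋃)
open import Data.Fin.Subset.Properties
  using (_∈?_; _⊆?_; ∉⊥; ⊆-antisym; x∈p∪q⁺; x∈p∪q⁻; p⊆p∪q; q⊆p∪q; x∈⁅x⁆; x∈⁅y⁆⇒x≡y)
open import Data.Vec using (lookup)
open import Data.Vec.Properties using (lookup⇒[]=; []=⇒lookup; ≡-dec)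
open import Data.List
  using (List; []; _∷_; _++_; reverse; map; concatMap; filter; allFin; length; take; drop)
import Data.List.Properties as List
open import Data.List.Membership.Propositional using () renaming (_∈_ to _∈ₗ_)
open import Data.List.Relation.Unary.Any using (here; there)
open import Data.List.Relation.Unary.All as All using (_∷_)
open import Data.List.Relation.Unary.AllPairs using (_∷_)
open import Data.List.Relation.Unary.Unique.Propositional using (Unique)
import Data.List.Relation.Unary.Unique.Propositional.Properties as Unique
open import Data.List.Membership.Propositional.Properties
  using (∈-map⁺; ∈-map⁻; ∈-filter⁺; ∈-filter⁻; ∈-allFin; ∈-++⁺ˡ; ∈-++⁺ʳ; ∈-++⁻)
open import Data.List.Relation.Binary.Permutation.Propositional
  using (_↭_; prep; ↭-refl; ↭-sym; ↭-trans; ↭⇒↭ₛ)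
open import Data.List.Relation.Binary.BagAndSetEquality using (∼bag⇒↭)
open import Data.List.Membership.Propositional.Properties.WithK using (unique∧set⇒bag)
open import Function.Bundles using (mk⇔)
open import Data.List.Relation.Binary.Permutation.Propositional.Properties using (∈-resp-↭; shift; ++⁺ˡ)
import Data.List.Relation.Binary.Permutation.Setoid.Properties as PermutationSetoid
open import Relation.Binary.Construct.Closure.ReflexiveTransitive using (Star; ε; _◅_)
open import Function using (_∘_)
open import Relation.Nullary using (¬_; Dec; yes; no; does; contradiction)
open import Relation.Nullary.Decidable using (dec-true; dec-false)
open import Relation.Unary using (Pred; Decidable)
open import Relation.Unary.Properties using (∁?)
open import Relation.Binary.Definitions using (DecidableEquality; tri<; tri≈; tri>)
open import Relation.Binary.PropositionalEquality as ≡ using (_≡_; _≢_; refl; cong; subst; subst₂)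

-- Lists and subsets

Unique-resp-↭ : ∀ {A : Set} {xs ys : List A} → xs ↭ ys → Unique xs → Unique ys
Unique-resp-↭ = PermutationSetoid.Unique-resp-↭ (≡.setoid _) ∘ ↭⇒↭ₛ

unique-middle : ∀ {A : Set} xs {y : A} ys → Unique (xs ++ y ∷ ys) → ¬ y ∈ₗ xs ++ ys × Unique (xs ++ ys)
unique-middle xs ys unique with Unique-resp-↭ (shift _ xs ys) unique
... | y∉ ∷ unique′ = (λ y∈ → All.lookup y∉ y∈ refl) , unique′

∈-insert : ∀ {A : Set} xs {y v : A} {ys} → v ∈ₗ xs ++ ys → v ∈ₗ xs ++ y ∷ ys
∈-insert xs v∈ with ∈-++⁻ xs v∈
... | inj₁ v∈xs = ∈-++⁺ˡ v∈xs
... | inj₂ v∈ys = ∈-++⁺ʳ xs (there v∈ys)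

unique-same-members⇒↭ : ∀ {A : Set} {xs ys : List A} → Unique xs → Unique ys
                        → (∀ {x} → x ∈ₗ xs → x ∈ₗ ys) → (∀ {x} → x ∈ₗ ys → x ∈ₗ xs) → xs ↭ ys
unique-same-members⇒↭ unique-xs unique-ys to from =
  ∼bag⇒↭ (unique∧set⇒bag unique-xs unique-ys (mk⇔ to from))

↭-filter-∁ : ∀ {A : Set} {P : A → Set} (P? : Decidable P) xs → xs ↭ filter P? xs ++ filter (∁? P?) xs
↭-filter-∁ P? [] = ↭-refl
↭-filter-∁ P? (x ∷ xs) with P? x
... | yes _ = prep x (↭-filter-∁ P? xs)
... | no _ = ↭-trans (prep x (↭-filter-∁ P? xs)) (↭-sym (shift x (filter P? xs) _))

take-length-++ : ∀ {A : Set} (xs ys : List A) → take (length xs) (xs ++ ys) ≡ xs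
take-length-++ [] ys = refl
take-length-++ (x ∷ xs) ys = cong (x ∷_) (take-length-++ xs ys)

drop-length-++ : ∀ {A : Set} (xs ys : List A) → drop (length xs) (xs ++ ys) ≡ ys
drop-length-++ [] ys = refl
drop-length-++ (x ∷ xs) ys = drop-length-++ xs ys

take-drop-blocks : ∀ {A : Set} (X Y Z : List A)
                   → let a = length X ; b = length X ℕ.+ length Y ; L = X ++ Y ++ Z in
                     a ℕ.≤ b × b ℕ.≤ length L
                     × take a L ≡ X × take (b ∸ a) (drop a L) ≡ Y × drop b L ≡ Z
take-drop-blocks X Y Z =
  ℕ.m≤m+n (length X) (length Y) ,
  subst (length X ℕ.+ length Y ℕ.≤_)
    (≡.sym (≡.trans (List.length-++ X) (cong (length X ℕ.+_) (List.length-++ Y))))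
    (ℕ.+-monoʳ-≤ (length X) (ℕ.m≤m+n (length Y) (length Z))) ,
  take-length-++ X (Y ++ Z) ,
  ≡.trans (≡.cong₂ take (ℕ.m+n∸m≡n (length X) (length Y)) (drop-length-++ X (Y ++ Z)))
    (take-length-++ Y Z) ,
  ≡.trans (≡.sym (List.drop-drop (length X) (length Y) (X ++ Y ++ Z)))
    (≡.trans (cong (drop (length Y)) (drop-length-++ X (Y ++ Z))) (drop-length-++ Y Z))

infix 4 _≟ₛ_
_≟ₛ_ : ∀ {n} → DecidableEquality (Subset n)
_≟ₛ_ = ≡-dec Bool._≟_

≟ₛ-cases : ∀ {n} {A : Set} (G H₁ H₂ : Subset n)
           → (G ≡ H₁ → A) → (G ≡ H₂ → A) → (G ≢ H₁ → G ≢ H₂ → A) → A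
≟ₛ-cases {A = A} G H₁ H₂ at₁ at₂ elsewhere = decide (G ≟ₛ H₁) (G ≟ₛ H₂)
  where
  decide : Dec (G ≡ H₁) → Dec (G ≡ H₂) → A
  decide (yes G≡H₁) _ = at₁ G≡H₁
  decide (no _) (yes G≡H₂) = at₂ G≡H₂
  decide (no G≢H₁) (no G≢H₂) = elsewhere G≢H₁ G≢H₂

∪-lub : ∀ {n} {S₁ S₂ : Subset n} {X : Fin n → Set}
        → (∀ {z} → z ∈ S₁ → X z) → (∀ {z} → z ∈ S₂ → X z) → ∀ {z} → z ∈ S₁ ∪ S₂ → X z
∪-lub in₁ in₂ z∈ = [ in₁ , in₂ ] (x∈p∪q⁻ _ _ z∈)

∈-⋃⁺ : ∀ {n} {P : Subset n} {Ps x} → P ∈ₗ Ps → x ∈ P → x ∈ ⋃ Ps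
∈-⋃⁺ (here refl) x∈P = x∈p∪q⁺ (inj₁ x∈P)
∈-⋃⁺ (there P∈) x∈P = x∈p∪q⁺ (inj₂ (∈-⋃⁺ P∈ x∈P))

⋃-lub : ∀ {n} {G : Subset n} Ps → (∀ {P} → P ∈ₗ Ps → P ⊆ G) → ⋃ Ps ⊆ G
⋃-lub [] _ x∈ = ⊥-elim (∉⊥ x∈)
⋃-lub (P ∷ Ps) ⊆G = ∪-lub (⊆G (here refl)) (⋃-lub Ps (⊆G ∘ there))

⁅⁆-⊆ : ∀ {n} {x : Fin n} {G} → x ∈ G → ⁅ x ⁆ ⊆ G
⁅⁆-⊆ {x = x} x∈G y∈ = subst (_∈ _) (≡.sym (x∈⁅y⁆⇒x≡y x y∈)) x∈G

≡-∪-⋃ : ∀ {n} {G Z : Subset n} Ps → Z ⊆ G → (∀ {P} → P ∈ₗ Ps → P ⊆ G)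
        → (∀ {x} → x ∈ G → x ∈ Z ⊎ ∃[ P ] (P ∈ₗ Ps × x ∈ P)) → G ≡ Z ∪ ⋃ Ps
≡-∪-⋃ Ps Z⊆G Ps⊆G cover = ⊆-antisym
  (λ x∈G → [ (λ x∈Z → x∈p∪q⁺ (inj₁ x∈Z)) , (λ { (P , P∈ , x∈P) → x∈p∪q⁺ (inj₂ (∈-⋃⁺ P∈ x∈P)) }) ]
             (cover x∈G))
  (∪-lub Z⊆G (⋃-lub Ps Ps⊆G))

-- Powers of two and levels

module PowersOfTwo where
  open import Data.Rational using (_≤_)

  private
    ℕ/1≡mkℚ : ∀ a → ℤ.+ a / 1 ≡ mkℚ (ℤ.+ a) 0 (coprime-sym (1-coprimeTo a))
    ℕ/1≡mkℚ a = ℚ.normalize-coprime _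

    mkℚ-≤ : ∀ {a b d e} .{c : Coprime a (suc d)} .{c′ : Coprime b (suc e)}
            → a ℕ.* suc e ℕ.≤ b ℕ.* suc d → mkℚ (ℤ.+ a) d c ≤ mkℚ (ℤ.+ b) e c′
    mkℚ-≤ {a} {b} {d} {e} le =
      *≤* (subst₂ ℤ._≤_ (≡.sym (ℤ.+◃n≡+n _)) (≡.sym (ℤ.+◃n≡+n _)) (ℤ.+≤+ le))

  ℕ/1-mono-≤ : ∀ {a b} → a ℕ.≤ b → ℤ.+ a / 1 ≤ ℤ.+ b / 1
  ℕ/1-mono-≤ {a} {b} a≤b rewrite ℕ/1≡mkℚ a | ℕ/1≡mkℚ b = mkℚ-≤ (ℕ.*-monoˡ-≤ 1 a≤b)

  ℕ/1-homo-+ : ∀ a b → ℤ.+ a / 1 + ℤ.+ b / 1 ≡ ℤ.+ (a ℕ.+ b) / 1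
  ℕ/1-homo-+ a b rewrite ℕ/1≡mkℚ a | ℕ/1≡mkℚ b =
    cong (_/ 1) (≡.cong₂ ℤ._+_ (ℤ.*-identityʳ (ℤ.+ a)) (ℤ.*-identityʳ (ℤ.+ b)))

  pow2-suc : ∀ k → pow2 (suc k) ≡ pow2 k + pow2 k
  pow2-suc k = ≡.trans (cong (λ m → ℤ.+ (2 ^ k ℕ.+ m) / 1) (ℕ.+-identityʳ (2 ^ k)))
                       (≡.sym (ℕ/1-homo-+ (2 ^ k) (2 ^ k)))

  pow2-mono-≤ : ∀ {j k} → j ℕ.≤ k → pow2 j ≤ pow2 k
  pow2-mono-≤ j≤k = ℕ/1-mono-≤ (ℕ.^-monoʳ-≤ 2 j≤k)

  0≤pow2 : ∀ k → 0ℚ ≤ pow2 k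
  0≤pow2 k = ℕ/1-mono-≤ {0} {2 ^ k} z≤n

  ≤-stepʳ : ∀ {a b c} → 0ℚ ≤ c → a ≤ b → a ≤ b + c
  ≤-stepʳ {a} {b} {c} 0≤c a≤b = ℚ.≤-trans a≤b
    (ℚ.≤-trans (ℚ.≤-reflexive (≡.sym (ℚ.+-identityʳ b))) (ℚ.+-monoʳ-≤ b 0≤c))

  ≤-stepˡ : ∀ {a b c} → 0ℚ ≤ c → a ≤ b → a ≤ c + b
  ≤-stepˡ {a} {b} {c} 0≤c a≤b = subst (a ≤_) (ℚ.+-comm b c) (≤-stepʳ 0≤c a≤b)

  private
    n<2^n : ∀ a → a ℕ.< 2 ^ a
    n<2^n zero = s≤s z≤n
    n<2^n (suc a) = ℕ.+-mono-≤ (ℕ.≤-trans (s≤s z≤n) (n<2^n a)) (ℕ.≤-trans (n<2^n a) (ℕ.m≤m+n (2 ^ a) 0))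

  ≤-some-pow2 : ∀ q → ∃[ j ] q ≤ pow2 j
  ≤-some-pow2 q@(mkℚ (ℤ.+ a) d _) = a , subst (q ≤_) (≡.sym (ℕ/1≡mkℚ (2 ^ a)))
    (mkℚ-≤ (ℕ.≤-trans (ℕ.≤-reflexive (ℕ.*-identityʳ a))
                      (ℕ.≤-trans (ℕ.<⇒≤ (n<2^n a)) (ℕ.m≤m*n (2 ^ a) (suc d)))))
  ≤-some-pow2 q@(mkℚ ℤ.-[1+ _ ] _ _) = 0 , subst (q ≤_) (≡.sym (ℕ/1≡mkℚ 1)) (*≤* ℤ.-≤+)

  least-witness : ∀ {p} {P : Pred ℕ p} → Decidable P → ∀ j → P j → ∃[ k ] (P k × (∀ m → P m → k ℕ.≤ m))
  least-witness P? j pj with P? 0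
  ... | yes p0 = 0 , p0 , λ _ _ → z≤n
  least-witness P? zero pj | no ¬p0 = contradiction pj ¬p0
  least-witness {P = P} P? (suc j) pj | no ¬p0 with least-witness (P? ∘ suc) j pj
  ... | k , pk , minimal = suc k , pk , above
    where
    above : ∀ m → P m → suc k ℕ.≤ m
    above zero p0 = contradiction p0 ¬p0
    above (suc m) pm = s≤s (minimal m pm)

  level-exists : ∀ q → ∃[ k ] Level q k
  level-exists q with ≤-some-pow2 q
  ... | j , q≤2^j = least-witness (λ k → q ℚ.≤? pow2 k) j q≤2^j

  level-mono : ∀ {q r k l} → q ≤ r → Level q k → Level r l → k ℕ.≤ l
  level-mono q≤r (_ , minimal) (r≤2^l , _) = minimal _ (ℚ.≤-trans q≤r r≤2^l)

  High : ℕ → ℚ → Set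
  High i q = ∃[ k ] (Level q k × i ℕ.≤ k)

  high-mono : ∀ {i q r} → q ≤ r → High i q → High i r
  high-mono q≤r (k , level-q , i≤k) with level-exists _
  ... | l , level-r = l , level-r , ℕ.≤-trans i≤k (level-mono q≤r level-q level-r)

open PowersOfTwo

-- Mate distances

module _ {n} (M : Metric n) where
  open Metric M
  open Gluttonous M using (mateDist)

  matches : Fin n → Fin n × Fin n → Bool
  matches t p = does (t ≟ proj₁ p) ∨ does (t ≟ proj₂ p)

  mate-or : Fin n → Fin n × Fin n → ℚ → ℚ
  mate-or t p r = if matches t p then d (proj₁ p) (proj₂ p) else r

  -- The local worker of `mateDist` cannot be named, so it is recovered as
  -- the solution of the metavariable `worker`; abstracting `p ∷ L` makes
  -- the unification problem a pattern.
  private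
    mutual
      worker : Fin n → List (Fin n × Fin n) → List (Fin n × Fin n) → ℚ
      worker = _

      unfold : ∀ p L t → mateDist (p ∷ L) t ≡ mate-or t p (worker t (p ∷ L) L)
      unfold p L t with p ∷ L
      ... | _ with matches t p
      ...   | true = refl
      ...   | false = refl

    worker≡mateDist : ∀ t D L → worker t D L ≡ mateDist L t
    worker≡mateDist t D [] = refl
    worker≡mateDist t D (p ∷ L) = ≡.trans (cong (mate-or t p) (worker≡mateDist t D L))
      (≡.sym (≡.trans (unfold p L t) (cong (mate-or t p) (worker≡mateDist t (p ∷ L) L))))

  mateDist-∷ : ∀ p L t → mateDist (p ∷ L) t ≡ mate-or t p (mateDist L t)
  mateDist-∷ p L t = ≡.trans (unfold p L t) (cong (mate-or t p) (worker≡mateDist t (p ∷ L) L))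

  mateDist-removed : ∀ {s s̄ t} A B → t ≢ s → t ≢ s̄
                     → mateDist (A ++ (s , s̄) ∷ B) t ≡ mateDist (A ++ B) t
  mateDist-removed {s} {s̄} {t} [] B t≢s t≢s̄
    rewrite mateDist-∷ (s , s̄) B t | dec-false (t ≟ s) t≢s | dec-false (t ≟ s̄) t≢s̄ = refl
  mateDist-removed {s} {s̄} {t} (p ∷ A) B t≢s t≢s̄ =
    ≡.trans (mateDist-∷ p (A ++ (s , s̄) ∷ B) t)
      (≡.trans (cong (mate-or t p) (mateDist-removed A B t≢s t≢s̄)) (≡.sym (mateDist-∷ p (A ++ B) t)))

  mateDist-mate : ∀ {s s̄ t} A B → ¬ t ∈ₗ endpoints A → t ≡ s ⊎ t ≡ s̄
                  → mateDist (A ++ (s , s̄) ∷ B) t ≡ d s s̄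
  mateDist-mate {s} {s̄} [] B _ (inj₁ refl)
    rewrite mateDist-∷ (s , s̄) B s | dec-true (s ≟ s) refl = refl
  mateDist-mate {s} {s̄} [] B _ (inj₂ refl)
    rewrite mateDist-∷ (s , s̄) B s̄ | dec-true (s̄ ≟ s̄) refl | Bool.∨-zeroʳ (does (s̄ ≟ s)) = refl
  mateDist-mate {s} {s̄} {t} (p ∷ A) B t∉ t≡
    rewrite mateDist-∷ p (A ++ (s , s̄) ∷ B) t
          | dec-false (t ≟ proj₁ p) (t∉ ∘ here) | dec-false (t ≟ proj₂ p) (t∉ ∘ there ∘ here)
    = mateDist-mate A B (t∉ ∘ there ∘ there) t≡

-- Contracted metrics

module Contraction {n} (M : Metric n) where
  open import Data.Rational using (_≤_; _<_)
  open Metric M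
  open Contracted M using (wt; walkLen)

  0≤d : ∀ x y → 0ℚ ≤ d x y
  0≤d x y with d-gap x y
  ... | inj₁ dxy≡0 = ℚ.≤-reflexive (≡.sym dxy≡0)
  ... | inj₂ 1≤dxy = ℚ.≤-trans (*≤* (ℤ.+≤+ z≤n)) 1≤dxy

  sameB-sound : ∀ (C : Clustering n) x y → sameB C x y ≡ true → ∃[ S ] (S ∈ₗ C × x ∈ S × y ∈ S)
  sameB-sound [] x y ()
  sameB-sound (S ∷ C) x y eq with lookup S x in x∈S | lookup S y in y∈S
  ... | true | true = S , here refl , lookup⇒[]= x S x∈S , lookup⇒[]= y S y∈S
  ... | true | false = map₂ (map₁ there) (sameB-sound C x y eq)
  ... | false | _ = map₂ (map₁ there) (sameB-sound C x y eq)

  sameB-complete : ∀ {C : Clustering n} {S x y} → S ∈ₗ C → x ∈ S → y ∈ S → sameB C x y ≡ true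
  sameB-complete (here refl) x∈S y∈S rewrite []=⇒lookup x∈S | []=⇒lookup y∈S = refl
  sameB-complete {S′ ∷ C} {x = x} {y} (there S∈C) x∈S y∈S
    rewrite sameB-complete {C} S∈C x∈S y∈S = Bool.∨-zeroʳ (lookup S′ x ∧ lookup S′ y)

  sameB-sym : ∀ (C : Clustering n) x y → sameB C x y ≡ sameB C y x
  sameB-sym [] x y = refl
  sameB-sym (S ∷ C) x y = ≡.cong₂ _∨_ (Bool.∧-comm (lookup S x) (lookup S y)) (sameB-sym C x y)

  wt≤d : ∀ C x y → wt C x y ≤ d x y
  wt≤d C x y with sameB C x y
  ... | true = 0≤d x y
  ... | false = ℚ.≤-refl

  0≤wt : ∀ C x y → 0ℚ ≤ wt C x y
  0≤wt C x y with sameB C x y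
  ... | true = ℚ.≤-refl
  ... | false = 0≤d x y

  wt-sym : ∀ C x y → wt C x y ≡ wt C y x
  wt-sym C x y = ≡.cong₂ (λ b r → if b then 0ℚ else r) (sameB-sym C x y) (d-sym x y)

  wt-refl : ∀ C x → wt C x x ≡ 0ℚ
  wt-refl C x with sameB C x x
  ... | true = refl
  ... | false = d-refl x

  wt-same : ∀ C x y → sameB C x y ≡ true → wt C x y ≡ 0ℚ
  wt-same C x y same rewrite same = refl

  wt-apart : ∀ C x y → sameB C x y ≡ false → wt C x y ≡ d x y
  wt-apart C x y apart rewrite apart = refl

  0≤walkLen : ∀ C x vs y → 0ℚ ≤ walkLen C x vs y
  0≤walkLen C x [] y = 0≤wt C x y
  0≤walkLen C x (v ∷ vs) y = ≤-stepʳ (0≤walkLen C v vs y) (0≤wt C x v)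

  walkLen-++ : ∀ C x vs y ws z → walkLen C x (vs ++ y ∷ ws) z ≡ walkLen C x vs y + walkLen C y ws z
  walkLen-++ C x [] y ws z = refl
  walkLen-++ C x (v ∷ vs) y ws z = ≡.trans (cong (wt C x v +_) (walkLen-++ C v vs y ws z))
    (≡.sym (ℚ.+-assoc (wt C x v) (walkLen C v vs y) (walkLen C y ws z)))

  walkLen-reverse : ∀ C x vs y → walkLen C y (reverse vs) x ≡ walkLen C x vs y
  walkLen-reverse C x [] y = wt-sym C y x
  walkLen-reverse C x (v ∷ vs) y = begin
    walkLen C y (reverse (v ∷ vs)) x       ≡⟨ cong (λ l → walkLen C y l x) (List.unfold-reverse v vs) ⟩
    walkLen C y (reverse vs ++ v ∷ []) x   ≡⟨ walkLen-++ C y (reverse vs) v [] x ⟩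
    walkLen C y (reverse vs) v + wt C v x  ≡⟨ ≡.cong₂ _+_ (walkLen-reverse C v vs y) (wt-sym C v x) ⟩
    walkLen C v vs y + wt C x v            ≡⟨ ℚ.+-comm (walkLen C v vs y) (wt C x v) ⟩
    wt C x v + walkLen C v vs y            ∎
    where open ≡.≡-Reasoning

  -- `Contracted.DistLe` as a record, so that C, x and y can be inferred.
  record Within (C : Clustering n) (x y : Fin n) (r : ℚ) : Set where
    constructor within
    field
      walk  : List (Fin n)
      bound : walkLen C x walk y ≤ r

  toDistLe : ∀ {C x y r} → Within C x y r → Contracted.DistLe M C x y r
  toDistLe (within vs le) = vs , le

  fromDistLe : ∀ {C x y r} → Contracted.DistLe M C x y r → Within C x y r
  fromDistLe (vs , le) = within vs le

  within-0≤ : ∀ {C x y r} → Within C x y r → 0ℚ ≤ r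
  within-0≤ {C} {x} {y} (within vs le) = ℚ.≤-trans (0≤walkLen C x vs y) le

  within-refl : ∀ {C} x → Within C x x 0ℚ
  within-refl {C} x = within [] (ℚ.≤-reflexive (wt-refl C x))

  within-same : ∀ {C S x y} → S ∈ₗ C → x ∈ S → y ∈ S → Within C x y 0ℚ
  within-same {C} {x = x} {y} S∈C x∈S y∈S =
    within [] (ℚ.≤-reflexive (wt-same C x y (sameB-complete S∈C x∈S y∈S)))

  within-trans : ∀ {C x y z a b} → Within C x y a → Within C y z b → Within C x z (a + b)
  within-trans {C} {x} {y} {z} (within vs p) (within ws q) =
    within (vs ++ y ∷ ws) (subst (_≤ _) (≡.sym (walkLen-++ C x vs y ws z)) (ℚ.+-mono-≤ p q))

  within-weaken : ∀ {C x y a b} → Within C x y a → a ≤ b → Within C x y b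
  within-weaken (within vs p) q = within vs (ℚ.≤-trans p q)

  within-sym : ∀ {C x y a} → Within C x y a → Within C y x a
  within-sym {C} {x} {y} (within vs p) =
    within (reverse vs) (subst (_≤ _) (≡.sym (walkLen-reverse C x vs y)) p)

  within-cluster : ∀ {C S x y z r} → Within C x y r → S ∈ₗ C → y ∈ S → z ∈ S → Within C x z r
  within-cluster {r = r} xy S∈ y∈S z∈S =
    within-weaken (within-trans xy (within-same S∈ y∈S z∈S)) (ℚ.≤-reflexive (ℚ.+-identityʳ r))

  infix 4 _⊑_
  _⊑_ : Clustering n → Clustering n → Set
  A ⊑ B = ∀ {S} → S ∈ₗ A → ∃[ G ] (G ∈ₗ B × S ⊆ G)

  ⊑-trans : ∀ {A B C} → A ⊑ B → B ⊑ C → A ⊑ C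
  ⊑-trans A⊑B B⊑C S∈A with A⊑B S∈A
  ... | G , G∈B , S⊆G with B⊑C G∈B
  ...   | H , H∈C , G⊆H = H , H∈C , G⊆H ∘ S⊆G

  private
    wt-antitone : ∀ {A B} → A ⊑ B → ∀ a b → wt B a b ≤ wt A a b
    wt-antitone {A} {B} A⊑B a b with sameB A a b in same
    ... | false = wt≤d B a b
    ... | true with sameB-sound A a b same
    ...   | S , S∈A , a∈S , b∈S with A⊑B S∈A
    ...     | G , G∈B , S⊆G rewrite sameB-complete G∈B (S⊆G a∈S) (S⊆G b∈S) = ℚ.≤-refl

    walkLen-antitone : ∀ {A B} → A ⊑ B → ∀ x vs y → walkLen B x vs y ≤ walkLen A x vs y
    walkLen-antitone A⊑B x [] y = wt-antitone A⊑B x y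
    walkLen-antitone A⊑B x (v ∷ vs) y = ℚ.+-mono-≤ (wt-antitone A⊑B x v) (walkLen-antitone A⊑B v vs y)

  within-⊑ : ∀ {A B x y r} → A ⊑ B → Within A x y r → Within B x y r
  within-⊑ {x = x} {y} A⊑B (within vs le) = within vs (ℚ.≤-trans (walkLen-antitone A⊑B x vs y) le)

  data Covered (B : Clustering n) (X Y : Fin n → Set) (R : Set) (S : Subset n) : Set where
    inside-B : ∀ {P} → P ∈ₗ B → S ⊆ P → Covered B X Y R S
    inside-X : (∀ {z} → z ∈ S → X z) → Covered B X Y R S
    inside-Y : (∀ {z} → z ∈ S → Y z) → Covered B X Y R S
    other    : R → Covered B X Y R S

  -- Where a walk of M/A ends up in M/B when its zero-length edges inside X
  -- or Y are lost: the last such edge determines the outcome.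
  data Exit (B : Clustering n) (X Y : Fin n → Set) (R : Set) (u v : Fin n) (r : ℚ) : Set where
    direct : Within B u v r → Exit B X Y R u v r
    near-X : ∀ {p} → X p → Within B p v r → Exit B X Y R u v r
    near-Y : ∀ {q} → Y q → Within B q v r → Exit B X Y R u v r
    bridge : ∀ {p q} → X p → Y q → Within B p q r → Exit B X Y R u v r
    other  : R → Exit B X Y R u v r

  -- The same for a walk starting in X: ending near Y forces a bridge.
  data ExitFrom (B : Clustering n) (X Y : Fin n → Set) (R : Set) (v : Fin n) (r : ℚ) : Set where
    near-X : ∀ {p} → X p → Within B p v r → ExitFrom B X Y R v r
    bridge : ∀ {p q} → X p → Y q → Within B p q r → ExitFrom B X Y R v r
    other  : R → ExitFrom B X Y R v r

  private
    ≤-dropʳ : ∀ {a b r} → 0ℚ ≤ b → a + b ≤ r → a ≤ r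
    ≤-dropʳ 0≤b le = ℚ.≤-trans (≤-stepʳ 0≤b ℚ.≤-refl) le

    ≤-dropˡ : ∀ {a b r} → 0ℚ ≤ a → a + b ≤ r → b ≤ r
    ≤-dropˡ 0≤a le = ℚ.≤-trans (≤-stepˡ 0≤a ℚ.≤-refl) le

    0+≤ : ∀ {b r} → b ≤ r → 0ℚ + b ≤ r
    0+≤ {b} = ℚ.≤-trans (ℚ.≤-reflexive (ℚ.+-identityˡ b))

    data Edge (A B : Clustering n) (X Y : Fin n → Set) (R : Set) (a b : Fin n) : Set where
      kept   : Within B a b (wt A a b) → Edge A B X Y R a b
      lost-X : X a → X b → Edge A B X Y R a b
      lost-Y : Y a → Y b → Edge A B X Y R a b
      other  : R → Edge A B X Y R a b

    swap-covered : ∀ {B X Y R S} → Covered B X Y R S → Covered B Y X R S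
    swap-covered (inside-B P∈ S⊆P) = inside-B P∈ S⊆P
    swap-covered (inside-X S⊆X) = inside-Y S⊆X
    swap-covered (inside-Y S⊆Y) = inside-X S⊆Y
    swap-covered (other r) = other r

    module FromX {A B X Y R} (covered : ∀ {S} → S ∈ₗ A → Covered B X Y R S) where

      edge : ∀ a b → Edge A B X Y R a b
      edge a b with sameB A a b in same
      ... | false = kept (within [] (ℚ.≤-trans (wt≤d B a b) (ℚ.≤-reflexive (≡.sym (wt-apart A a b same)))))
      ... | true with sameB-sound A a b same
      ...   | S , S∈A , a∈S , b∈S with covered S∈A
      ...     | inside-B P∈B S⊆P = kept (within-weaken (within-same P∈B (S⊆P a∈S) (S⊆P b∈S))
                                               (ℚ.≤-reflexive (≡.sym (wt-same A a b same))))
      ...     | inside-X S⊆X = lost-X (S⊆X a∈S) (S⊆X b∈S)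
      ...     | inside-Y S⊆Y = lost-Y (S⊆Y a∈S) (S⊆Y b∈S)
      ...     | other r = other r

      from-X : ∀ {p a ℓ r} → X p → Within B p a ℓ → ∀ vs v
               → ℓ + walkLen A a vs v ≤ r → ExitFrom B X Y R v r
      from-X {p} {a} p∈X pa [] v le with edge a v
      ... | kept av = near-X p∈X (within-weaken (within-trans pa av) le)
      ... | lost-X _ v∈X = near-X v∈X (within-weaken (within-refl v)
                                         (ℚ.≤-trans (within-0≤ pa) (≤-dropʳ (0≤wt A a v) le)))
      ... | lost-Y a∈Y _ = bridge p∈X a∈Y (within-weaken pa (≤-dropʳ (0≤wt A a v) le))
      ... | other r = other r
      from-X {p} {a} {ℓ} p∈X pa (w ∷ ws) v le with edge a w
      ... | kept aw = from-X p∈X (within-trans pa aw) ws v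
                        (ℚ.≤-trans (ℚ.≤-reflexive (ℚ.+-assoc ℓ (wt A a w) _)) le)
      ... | lost-X _ w∈X = from-X w∈X (within-refl w) ws v
                             (0+≤ (≤-dropˡ (0≤wt A a w) (≤-dropˡ (within-0≤ pa) le)))
      ... | lost-Y a∈Y _ = bridge p∈X a∈Y (within-weaken pa (≤-dropʳ (0≤walkLen A a (w ∷ ws) v) le))
      ... | other r = other r

    module FromAny {A B X Y R} (covered : ∀ {S} → S ∈ₗ A → Covered B X Y R S) where
      open FromX covered
      open FromX (swap-covered ∘ covered) using () renaming (from-X to from-Y)

      via-X : ∀ {u v r} → ExitFrom B X Y R v r → Exit B X Y R u v r
      via-X (near-X p∈X pv) = near-X p∈X pv
      via-X (bridge p∈X q∈Y pq) = bridge p∈X q∈Y pq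
      via-X (other r) = other r

      via-Y : ∀ {u v r} → ExitFrom B Y X R v r → Exit B X Y R u v r
      via-Y (near-X q∈Y qv) = near-Y q∈Y qv
      via-Y (bridge q∈Y p∈X qp) = bridge p∈X q∈Y (within-sym qp)
      via-Y (other r) = other r

      from-any : ∀ {u a ℓ r} → Within B u a ℓ → ∀ vs v
                 → ℓ + walkLen A a vs v ≤ r → Exit B X Y R u v r
      from-any {u} {a} ua [] v le with edge a v
      ... | kept av = direct (within-weaken (within-trans ua av) le)
      ... | lost-X _ v∈X = near-X v∈X (within-weaken (within-refl v)
                                         (ℚ.≤-trans (within-0≤ ua) (≤-dropʳ (0≤wt A a v) le)))
      ... | lost-Y _ v∈Y = near-Y v∈Y (within-weaken (within-refl v)
                                         (ℚ.≤-trans (within-0≤ ua) (≤-dropʳ (0≤wt A a v) le)))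
      ... | other r = other r
      from-any {u} {a} {ℓ} ua (w ∷ ws) v le with edge a w
      ... | kept aw = from-any (within-trans ua aw) ws v
                        (ℚ.≤-trans (ℚ.≤-reflexive (ℚ.+-assoc ℓ (wt A a w) _)) le)
      ... | lost-X _ w∈X = via-X (from-X w∈X (within-refl w) ws v
                                   (0+≤ (≤-dropˡ (0≤wt A a w) (≤-dropˡ (within-0≤ ua) le))))
      ... | lost-Y _ w∈Y = via-Y (from-Y w∈Y (within-refl w) ws v
                                   (0+≤ (≤-dropˡ (0≤wt A a w) (≤-dropˡ (within-0≤ ua) le))))
      ... | other r = other r

  exit : ∀ {A B X Y R u v r} → (∀ {S} → S ∈ₗ A → Covered B X Y R S)
         → Within A u v r → Exit B X Y R u v r
  exit covered (within vs le) = FromAny.from-any covered (within-refl _) vs _ (0+≤ le)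

  exit-from : ∀ {A B X Y R u v r} → (∀ {S} → S ∈ₗ A → Covered B X Y R S)
              → X u → Within A u v r → ExitFrom B X Y R v r
  exit-from covered u∈X (within vs le) = FromX.from-X covered u∈X (within-refl _) vs _ (0+≤ le)

-- Runs of the gluttonous algorithm

module Run {n} (M : Metric n) (D : List (Fin n × Fin n)) where
  open import Data.Rational using (_≤_; _<_)
  open Gluttonous M D public
  open Contraction M

  Outranks : Fin n → Fin n → Set
  Outranks a b = mateDist b < mateDist a ⊎ (mateDist b ≡ mateDist a × toℕ a ℕ.≤ toℕ b)

  private
    outranks-refl : ∀ a → Outranks a a
    outranks-refl a = inj₂ (refl , ℕ.≤-refl)

    outranks-total : ∀ a b → Outranks a b ⊎ Outranks b a
    outranks-total a b with ℚ.<-cmp (mateDist a) (mateDist b)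
    ... | tri< a<b _ _ = inj₂ (inj₁ a<b)
    ... | tri> _ _ b<a = inj₁ (inj₁ b<a)
    ... | tri≈ _ a≡b _ with ℕ.≤-total (toℕ a) (toℕ b)
    ...   | inj₁ a≤b = inj₁ (inj₂ (≡.sym a≡b , a≤b))
    ...   | inj₂ b≤a = inj₂ (inj₂ (a≡b , b≤a))

    outranks-trans : ∀ {a b c} → Outranks a b → Outranks b c → Outranks a c
    outranks-trans (inj₁ b<a) (inj₁ c<b) = inj₁ (ℚ.<-trans c<b b<a)
    outranks-trans {a} (inj₁ b<a) (inj₂ (c≡b , _)) = inj₁ (subst (_< mateDist a) (≡.sym c≡b) b<a)
    outranks-trans {c = c} (inj₂ (b≡a , _)) (inj₁ c<b) = inj₁ (subst (mateDist c <_) b≡a c<b)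
    outranks-trans (inj₂ (b≡a , a≤b)) (inj₂ (c≡b , b≤c)) = inj₂ (≡.trans c≡b b≡a , ℕ.≤-trans a≤b b≤c)

    best : ∀ y ys → ∃[ l ] (l ∈ₗ y ∷ ys × (∀ {t} → t ∈ₗ y ∷ ys → Outranks l t))
    best y [] = y , here refl , λ { (here refl) → outranks-refl y }
    best y (z ∷ zs) with best z zs
    ... | l , l∈ , l-best with outranks-total y l
    ...   | inj₁ y≥l = y , here refl , λ { (here refl) → outranks-refl y
                                         ; (there t∈) → outranks-trans y≥l (l-best t∈) }
    ...   | inj₂ l≥y = l , there l∈ , λ { (here refl) → l≥y ; (there t∈) → l-best t∈ }

    leader-among : ∀ {S} ms → (∀ {t} → t ∈ₗ ms → t ∈ S) → (∀ {t} → t ∈ S → t ∈ₗ ms)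
                   → ∀ {x} → x ∈ₗ ms → ∃[ l ] IsLeader S l
    leader-among (y ∷ ys) sound complete _ with best y ys
    ... | l , l∈ , l-best = l , sound l∈ , λ t t∈S → l-best (complete t∈S)

  leader-exists : ∀ {S x} → x ∈ S → ∃[ l ] IsLeader S l
  leader-exists {S} {x} x∈S =
    leader-among (filter (_∈? S) (allFin n)) (proj₂ ∘ ∈-filter⁻ (_∈? S) {xs = allFin n})
      (λ {t} → ∈-filter⁺ (_∈? S) (∈-allFin t)) (∈-filter⁺ (_∈? S) (∈-allFin x) x∈S)

  active-intro : ∀ {i S t} → t ∈ S → High i (mateDist t) → Active i S
  active-intro t∈S high with leader-exists t∈S
  ... | l , l∈S , l-best = l , (l∈S , l-best) , high-mono (outranks⇒≥ (l-best _ t∈S)) high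
    where
    outranks⇒≥ : ∀ {a b} → Outranks a b → mateDist b ≤ mateDist a
    outranks⇒≥ (inj₁ b<a) = ℚ.<⇒≤ b<a
    outranks⇒≥ (inj₂ (b≡a , _)) = ℚ.≤-reflexive b≡a

  active-⊆ : ∀ {i S G} → S ⊆ G → Active i S → Active i G
  active-⊆ S⊆G (t , (t∈S , _) , high) = active-intro (S⊆G t∈S) high

  Terminal : Fin n → Set
  Terminal x = x ∈ₗ endpoints D

  record IsPartition (C : Clustering n) : Set where
    field
      nonempty : ∀ {S} → S ∈ₗ C → ∃[ x ] x ∈ S
      disjoint : ∀ {S S′ x} → S ∈ₗ C → S′ ∈ₗ C → x ∈ S → x ∈ S′ → S ≡ S′
      unique   : Unique C
      terminal : ∀ {S x} → S ∈ₗ C → x ∈ S → Terminal x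
      covering : ∀ {x} → Terminal x → ∃[ S ] (S ∈ₗ C × x ∈ S)

  private
    singletons≡ : ∀ (E : List (Fin n × Fin n))
                  → concatMap (λ p → ⁅ proj₁ p ⁆ ∷ ⁅ proj₂ p ⁆ ∷ []) E ≡ map ⁅_⁆ (endpoints E)
    singletons≡ [] = refl
    singletons≡ (p ∷ E) = cong (λ Ss → ⁅ proj₁ p ⁆ ∷ ⁅ proj₂ p ⁆ ∷ Ss) (singletons≡ E)

    ⁅⁆-injective : ∀ {x y : Fin n} → ⁅ x ⁆ ≡ ⁅ y ⁆ → x ≡ y
    ⁅⁆-injective {x} {y} eq = x∈⁅y⁆⇒x≡y y (subst (x ∈_) eq (x∈⁅x⁆ x))

  ∈-singletons : ∀ {x} → Terminal x → ⁅ x ⁆ ∈ₗ singletons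
  ∈-singletons t = subst (_ ∈ₗ_) (≡.sym (singletons≡ D)) (∈-map⁺ ⁅_⁆ t)

  ∈-singletons⁻ : ∀ {S} → S ∈ₗ singletons → ∃[ x ] (Terminal x × S ≡ ⁅ x ⁆)
  ∈-singletons⁻ S∈ = ∈-map⁻ ⁅_⁆ (subst (_ ∈ₗ_) (singletons≡ D) S∈)

  singletons-partition : Unique (endpoints D) → IsPartition singletons
  singletons-partition unique-endpoints = record
    { nonempty = nonempty
    ; disjoint = disjoint
    ; unique   = subst Unique (≡.sym (singletons≡ D)) (Unique.map⁺ ⁅⁆-injective unique-endpoints)
    ; terminal = terminal
    ; covering = λ {x} t → ⁅ x ⁆ , ∈-singletons t , x∈⁅x⁆ x
    }
    where
    nonempty : ∀ {S} → S ∈ₗ singletons → ∃[ x ] x ∈ S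
    nonempty S∈ with ∈-singletons⁻ S∈
    ... | x , _ , refl = x , x∈⁅x⁆ x
    disjoint : ∀ {S S′ x} → S ∈ₗ singletons → S′ ∈ₗ singletons → x ∈ S → x ∈ S′ → S ≡ S′
    disjoint S∈ S′∈ x∈S x∈S′ with ∈-singletons⁻ S∈ | ∈-singletons⁻ S′∈
    ... | y , _ , refl | y′ , _ , refl = cong ⁅_⁆ (≡.trans (≡.sym (x∈⁅y⁆⇒x≡y y x∈S)) (x∈⁅y⁆⇒x≡y y′ x∈S′))
    terminal : ∀ {S x} → S ∈ₗ singletons → x ∈ S → Terminal x
    terminal S∈ x∈S with ∈-singletons⁻ S∈
    ... | y , t , refl = subst Terminal (≡.sym (x∈⁅y⁆⇒x≡y y x∈S)) t

  partition-resp-↭ : ∀ {C C′} → C ↭ C′ → IsPartition C → IsPartition C′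
  partition-resp-↭ C↭C′ P = record
    { nonempty = λ S∈ → nonempty (back S∈)
    ; disjoint = λ S∈ S′∈ → disjoint (back S∈) (back S′∈)
    ; unique   = Unique-resp-↭ C↭C′ unique
    ; terminal = λ S∈ → terminal (back S∈)
    ; covering = λ t → let S , S∈ , x∈S = covering t in S , ∈-resp-↭ C↭C′ S∈ , x∈S
    }
    where
    open IsPartition P
    back : ∀ {S} → S ∈ₗ _ → S ∈ₗ _
    back = ∈-resp-↭ (↭-sym C↭C′)

  partition-merge : ∀ {S₁ S₂ rest} → IsPartition (S₁ ∷ S₂ ∷ rest) → IsPartition ((S₁ ∪ S₂) ∷ rest)
  partition-merge {S₁} {S₂} {rest} P with IsPartition.unique P
  ... | (_ ∷ S₁∉rest) ∷ (S₂∉rest ∷ unique-rest) = record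
    { nonempty = nonempty′
    ; disjoint = disjoint′
    ; unique   = All.tabulate (λ R∈ S≡R → outside R∈ (proj₂ inhabited) (subst (_ ∈_) S≡R (proj₂ inhabited)))
                 ∷ unique-rest
    ; terminal = terminal′
    ; covering = covering′
    }
    where
    open IsPartition P
    inhabited : ∃[ x ] x ∈ S₁ ∪ S₂
    inhabited = map₂ (λ x∈S₁ → x∈p∪q⁺ (inj₁ x∈S₁)) (nonempty (here refl))

    outside : ∀ {R y} → R ∈ₗ rest → y ∈ S₁ ∪ S₂ → y ∉ R
    outside R∈ y∈ y∈R with x∈p∪q⁻ S₁ S₂ y∈
    ... | inj₁ y∈S₁ = All.lookup S₁∉rest R∈ (disjoint (here refl) (there (there R∈)) y∈S₁ y∈R)
    ... | inj₂ y∈S₂ = All.lookup S₂∉rest R∈ (disjoint (there (here refl)) (there (there R∈)) y∈S₂ y∈R)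

    nonempty′ : ∀ {S} → S ∈ₗ (S₁ ∪ S₂) ∷ rest → ∃[ y ] y ∈ S
    nonempty′ (here refl) = inhabited
    nonempty′ (there S∈) = nonempty (there (there S∈))

    disjoint′ : ∀ {S S′ y} → S ∈ₗ (S₁ ∪ S₂) ∷ rest → S′ ∈ₗ (S₁ ∪ S₂) ∷ rest → y ∈ S → y ∈ S′ → S ≡ S′
    disjoint′ (here refl) (here refl) _ _ = refl
    disjoint′ (here refl) (there R∈) y∈ y∈R = ⊥-elim (outside R∈ y∈ y∈R)
    disjoint′ (there R∈) (here refl) y∈R y∈ = ⊥-elim (outside R∈ y∈ y∈R)
    disjoint′ (there S∈) (there S′∈) = disjoint (there (there S∈)) (there (there S′∈))

    terminal′ : ∀ {S y} → S ∈ₗ (S₁ ∪ S₂) ∷ rest → y ∈ S → Terminal y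
    terminal′ (here refl) y∈ with x∈p∪q⁻ S₁ S₂ y∈
    ... | inj₁ y∈S₁ = terminal (here refl) y∈S₁
    ... | inj₂ y∈S₂ = terminal (there (here refl)) y∈S₂
    terminal′ (there S∈) = terminal (there (there S∈))

    covering′ : ∀ {y} → Terminal y → ∃[ S ] (S ∈ₗ (S₁ ∪ S₂) ∷ rest × y ∈ S)
    covering′ t with covering t
    ... | S , here refl , y∈S = S₁ ∪ S₂ , here refl , p⊆p∪q S₂ y∈S
    ... | S , there (here refl) , y∈S = S₁ ∪ S₂ , here refl , q⊆p∪q S₁ S₂ y∈S
    ... | S , there (there S∈) , y∈S = S , there S∈ , y∈S

  step-partition : ∀ {i C C′} → Step i C C′ → IsPartition C → IsPartition C′
  step-partition (_ , _ , _ , C↭ , _ , _ , _ , _ , refl) = partition-merge ∘ partition-resp-↭ C↭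

  run-partition : ∀ {i C Q} → Star (Step i) C Q → IsPartition C → IsPartition Q
  run-partition ε = λ P → P
  run-partition (step ◅ run) = run-partition run ∘ step-partition step

  step-⊑ : ∀ {i C C′} → Step i C C′ → C ⊑ C′
  step-⊑ (S₁ , S₂ , rest , C↭ , _ , _ , _ , _ , refl) {S} S∈ with ∈-resp-↭ C↭ S∈
  ... | here refl = S₁ ∪ S₂ , here refl , p⊆p∪q S₂
  ... | there (here refl) = S₁ ∪ S₂ , here refl , q⊆p∪q S₁ S₂
  ... | there (there S∈rest) = S , there S∈rest , λ x∈ → x∈

  run-⊑ : ∀ {i C Q} → Star (Step i) C Q → C ⊑ Q
  run-⊑ ε S∈ = _ , S∈ , λ x∈ → x∈
  run-⊑ (step ◅ run) = ⊑-trans (step-⊑ step) (run-⊑ run)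

  stuck⇒same : ∀ {i C S₁ S₂ u v} → ¬ CanMerge i C → S₁ ∈ₗ C → S₂ ∈ₗ C → Active i S₁ → Active i S₂
               → u ∈ S₁ → v ∈ S₂ → Within C u v (pow2 (suc i)) → S₁ ≡ S₂
  stuck⇒same stuck S₁∈ S₂∈ active₁ active₂ u∈ v∈ uv with _ ≟ₛ _
  ... | yes S₁≡S₂ = S₁≡S₂
  ... | no S₁≢S₂ =
    ⊥-elim (stuck (_ , _ , S₁∈ , S₂∈ , S₁≢S₂ , active₁ , active₂ , _ , _ , u∈ , v∈ , toDistLe uv))

  stuck⇒common : ∀ {i C G₁ G₂ S₁ S₂ u v} → ¬ CanMerge i C → G₁ ∈ₗ C → G₂ ∈ₗ C
                 → Active i G₁ → Active i G₂ → S₁ ⊆ G₁ → S₂ ⊆ G₂ → u ∈ S₁ → v ∈ S₂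
                 → Within C u v (pow2 (suc i)) → ∃[ G ] (G ∈ₗ C × S₁ ⊆ G × S₂ ⊆ G)
  stuck⇒common stuck G₁∈ G₂∈ active₁ active₂ S₁⊆G₁ S₂⊆G₂ u∈ v∈ uv
    with stuck⇒same stuck G₁∈ G₂∈ active₁ active₂ (S₁⊆G₁ u∈) (S₂⊆G₂ v∈) uv
  ... | refl = _ , G₁∈ , S₁⊆G₁ , S₂⊆G₂

  record Merge (i : ℕ) (C : Clustering n) (S₁ S₂ : Subset n) : Set where
    field
      partition : IsPartition C
      S₁∈C      : S₁ ∈ₗ C
      S₂∈C      : S₂ ∈ₗ C
      active₁   : Active i S₁
      active₂   : Active i S₂
      {u v}     : Fin n
      u∈S₁      : u ∈ S₁
      v∈S₂      : v ∈ S₂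
      close     : Within C u v (pow2 (suc i))

  Preserved : ℕ → (Subset n → Set) → Set
  Preserved i P = ∀ {C S₁ S₂} → Merge i C S₁ S₂ → (∀ {S} → S ∈ₗ C → P S) → P (S₁ ∪ S₂)

  run-invariant : ∀ {i C Q} (P : Subset n → Set) → Preserved i P → Star (Step i) C Q
                  → IsPartition C → (∀ {S} → S ∈ₗ C → P S) → (∀ {S} → S ∈ₗ Q → P S)
  run-invariant P preserved ε _ every = every
  run-invariant P preserved (step ◅ run) partition every =
    run-invariant P preserved run (step-partition step partition) (after step)
    where
    after : ∀ {C′} → Step _ _ C′ → (∀ {S} → S ∈ₗ C′ → P S)
    after (S₁ , S₂ , rest , C↭ , _ , active₁ , active₂ , (_ , _ , u∈S₁ , v∈S₂ , close) , refl) =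
      λ { (here refl) → preserved merge every ; (there S∈) → every (back (there (there S∈))) }
      where
      back : ∀ {S} → S ∈ₗ S₁ ∷ S₂ ∷ rest → S ∈ₗ _
      back = ∈-resp-↭ (↭-sym C↭)
      merge : Merge _ _ S₁ S₂
      merge = record
        { partition = partition ; S₁∈C = back (here refl) ; S₂∈C = back (there (here refl))
        ; active₁ = active₁ ; active₂ = active₂ ; u∈S₁ = u∈S₁ ; v∈S₂ = v∈S₂ ; close = fromDistLe close }

-- Removing one demand pair

module Removal {n} (M : Metric n) (pre post : List (Fin n × Fin n)) (s s̄ : Fin n)
               (valid : ValidInstance M (pre ++ (s , s̄) ∷ post)) where
  open import Data.Rational using (_≤_)
  open Metric M
  open Contraction M
  module I = Run M (pre ++ (s , s̄) ∷ post)
  module J = Run M (pre ++ post)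

  private
    EP EQ : List (Fin n)
    EP = endpoints pre
    EQ = endpoints post

    endpoints-I : endpoints (pre ++ (s , s̄) ∷ post) ≡ EP ++ s ∷ s̄ ∷ EQ
    endpoints-I = List.concatMap-++ _ pre ((s , s̄) ∷ post)

    endpoints-J : endpoints (pre ++ post) ≡ EP ++ EQ
    endpoints-J = List.concatMap-++ _ pre post

    unique-I : Unique (EP ++ s ∷ s̄ ∷ EQ)
    unique-I = subst Unique endpoints-I (proj₂ valid)

    unique-I-s : Unique (EP ++ s̄ ∷ EQ)
    unique-I-s = proj₂ (unique-middle EP (s̄ ∷ EQ) unique-I)

    s∉ : ¬ s ∈ₗ EP ++ s̄ ∷ EQ
    s∉ = proj₁ (unique-middle EP (s̄ ∷ EQ) unique-I)

    s̄∉ : ¬ s̄ ∈ₗ EP ++ EQ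
    s̄∉ = proj₁ (unique-middle EP EQ unique-I-s)

  unique-J : Unique (endpoints (pre ++ post))
  unique-J = subst Unique (≡.sym endpoints-J) (proj₂ (unique-middle EP EQ unique-I-s))

  s≢s̄ : s ≢ s̄
  s≢s̄ s≡s̄ = s∉ (∈-++⁺ʳ EP (here s≡s̄))

  J-terminal⇒≢s : ∀ {x} → J.Terminal x → x ≢ s
  J-terminal⇒≢s x∈ refl = s∉ (∈-insert EP (subst (_ ∈ₗ_) endpoints-J x∈))

  J-terminal⇒≢s̄ : ∀ {x} → J.Terminal x → x ≢ s̄
  J-terminal⇒≢s̄ x∈ refl = s̄∉ (subst (_ ∈ₗ_) endpoints-J x∈)

  J⇒I-terminal : ∀ {x} → J.Terminal x → I.Terminal x
  J⇒I-terminal x∈ = subst (_ ∈ₗ_) (≡.sym endpoints-I)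
    (∈-insert EP (∈-insert EP {s̄} (subst (_ ∈ₗ_) endpoints-J x∈)))

  I-terminal⁻ : ∀ {x} → I.Terminal x → J.Terminal x ⊎ x ≡ s ⊎ x ≡ s̄
  I-terminal⁻ x∈ with ∈-++⁻ EP (subst (_ ∈ₗ_) endpoints-I x∈)
  ... | inj₁ x∈EP = inj₁ (subst (_ ∈ₗ_) (≡.sym endpoints-J) (∈-++⁺ˡ x∈EP))
  ... | inj₂ (here x≡s) = inj₂ (inj₁ x≡s)
  ... | inj₂ (there (here x≡s̄)) = inj₂ (inj₂ x≡s̄)
  ... | inj₂ (there (there x∈EQ)) = inj₁ (subst (_ ∈ₗ_) (≡.sym endpoints-J) (∈-++⁺ʳ EP x∈EQ))

  s-terminal : I.Terminal s
  s-terminal = subst (_ ∈ₗ_) (≡.sym endpoints-I) (∈-++⁺ʳ EP (here refl))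

  s̄-terminal : I.Terminal s̄
  s̄-terminal = subst (_ ∈ₗ_) (≡.sym endpoints-I) (∈-++⁺ʳ EP (there (here refl)))

  mateDist-J⇒I : ∀ {t} → J.Terminal t → I.mateDist t ≡ J.mateDist t
  mateDist-J⇒I t∈ = mateDist-removed M pre post (J-terminal⇒≢s t∈) (J-terminal⇒≢s̄ t∈)

  active-J⇒I : ∀ {i S G} → (∀ {z} → z ∈ S → J.Terminal z) → S ⊆ G → J.Active i S → I.Active i G
  active-J⇒I terminal S⊆G (t , (t∈S , _) , high) =
    I.active-intro (S⊆G t∈S) (subst (High _) (≡.sym (mateDist-J⇒I (terminal t∈S))) high)

  active-I⇒J : ∀ {i S G} → (∀ {z} → z ∈ G → J.Terminal z) → S ⊆ G → I.Active i S → J.Active i G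
  active-I⇒J terminal S⊆G (t , (t∈S , _) , high) =
    J.active-intro (S⊆G t∈S) (subst (High _) (mateDist-J⇒I (terminal (S⊆G t∈S))) high)

  active-s : ∀ {i k G} → Level (d s s̄) k → i ℕ.≤ k → s ∈ G → I.Active i G
  active-s level i≤k s∈G = I.active-intro s∈G
    (subst (High _) (≡.sym (mateDist-mate M pre post (s∉ ∘ ∈-++⁺ˡ) (inj₁ refl))) (_ , level , i≤k))

  active-s̄ : ∀ {i k G} → Level (d s s̄) k → i ℕ.≤ k → s̄ ∈ G → I.Active i G
  active-s̄ level i≤k s̄∈G = I.active-intro s̄∈G
    (subst (High _) (≡.sym (mateDist-mate M pre post (s̄∉ ∘ ∈-++⁺ˡ) (inj₂ refl))) (_ , level , i≤k))

  -- `untouched` and `pieces` give the enumeration (a); `separated` and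
  -- `joined` are (b) and (c).
  record Invariant (i : ℕ) (C C′ : Clustering n) : Set where
    field
      I-partition : I.IsPartition C
      J-partition : J.IsPartition C′
      Cs Cs̄      : Subset n
      Cs∈C       : Cs ∈ₗ C
      s∈Cs       : s ∈ Cs
      Cs̄∈C       : Cs̄ ∈ₗ C
      s̄∈Cs̄       : s̄ ∈ Cs̄
      untouched  : ∀ {G} → G ∈ₗ C → s ∉ G → s̄ ∉ G → G ∈ₗ C′
      pieces     : ∀ {P} → P ∈ₗ C′ → P ⊆ Cs ⊎ P ⊆ Cs̄ ⊎ P ∈ₗ C
      separated  : Cs ≢ Cs̄ → (∀ {v} → v ∈ Cs → Within C′ s v (pow2 (suc i)))
                             × (∀ {v} → v ∈ Cs̄ → Within C′ s̄ v (pow2 (suc i)))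
      joined     : Cs ≡ Cs̄ → Within C′ s s̄ (pow2 (suc (suc i)))

  invariant-start : Invariant 0 I.singletons J.singletons
  invariant-start = record
    { I-partition = I.singletons-partition (proj₂ valid)
    ; J-partition = J.singletons-partition unique-J
    ; Cs = ⁅ s ⁆ ; Cs̄ = ⁅ s̄ ⁆
    ; Cs∈C = I.∈-singletons s-terminal ; s∈Cs = x∈⁅x⁆ s
    ; Cs̄∈C = I.∈-singletons s̄-terminal ; s̄∈Cs̄ = x∈⁅x⁆ s̄
    ; untouched = untouched
    ; pieces = λ P∈ → let x , x∈ , P≡ = J.∈-singletons⁻ P∈ in
                      inj₂ (inj₂ (subst (_∈ₗ I.singletons) (≡.sym P≡) (I.∈-singletons (J⇒I-terminal x∈))))
    ; separated = λ _ → at-self s , at-self s̄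
    ; joined = λ ⁅s⁆≡⁅s̄⁆ → ⊥-elim (s≢s̄ (x∈⁅y⁆⇒x≡y s̄ (subst (s ∈_) ⁅s⁆≡⁅s̄⁆ (x∈⁅x⁆ s))))
    }
    where
    untouched : ∀ {G} → G ∈ₗ I.singletons → s ∉ G → s̄ ∉ G → G ∈ₗ J.singletons
    untouched G∈ s∉G s̄∉G with I.∈-singletons⁻ G∈
    ... | x , x∈ , refl with I-terminal⁻ x∈
    ...   | inj₁ x∈J = J.∈-singletons x∈J
    ...   | inj₂ (inj₁ refl) = ⊥-elim (s∉G (x∈⁅x⁆ s))
    ...   | inj₂ (inj₂ refl) = ⊥-elim (s̄∉G (x∈⁅x⁆ s̄))

    at-self : ∀ x {v} → v ∈ ⁅ x ⁆ → Within J.singletons x v (pow2 1)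
    at-self x v∈ rewrite x∈⁅y⁆⇒x≡y x v∈ = within-weaken (within-refl x) (0≤pow2 1)

  module Stage {i k} (level : Level (d s s̄) k) (i≤k : i ℕ.≤ k) {C C′ F F′ : Clustering n}
               (inv : Invariant i C C′)
               (run : Star (I.Step i) C F) (stuck : ¬ I.CanMerge i F)
               (run′ : Star (J.Step i) C′ F′) (stuck′ : ¬ J.CanMerge i F′) where
    open Invariant inv

    r₁ r₂ r₃ : ℚ
    r₁ = pow2 (suc i)
    r₂ = pow2 (suc (suc i))
    r₃ = pow2 (suc (suc (suc i)))

    partition-F : I.IsPartition F
    partition-F = I.run-partition run I-partition

    partition-F′ : J.IsPartition F′
    partition-F′ = J.run-partition run′ J-partition

    open I.IsPartition I-partition using () renaming (disjoint to C-disjoint)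
    open I.IsPartition partition-F using ()
      renaming (nonempty to F-nonempty; disjoint to F-disjoint)
    open J.IsPartition partition-F′ using ()
      renaming (nonempty to F′-nonempty; disjoint to F′-disjoint; terminal to F′-terminal)

    F-same : ∀ {G₁ G₂ u v} → G₁ ∈ₗ F → G₂ ∈ₗ F → I.Active i G₁ → I.Active i G₂
             → u ∈ G₁ → v ∈ G₂ → Within F u v r₁ → G₁ ≡ G₂
    F-same = I.stuck⇒same stuck

    F′-same : ∀ {P₁ P₂ u v} → P₁ ∈ₗ F′ → P₂ ∈ₗ F′ → J.Active i P₁ → J.Active i P₂
              → u ∈ P₁ → v ∈ P₂ → Within F′ u v r₁ → P₁ ≡ P₂
    F′-same = J.stuck⇒same stuck′

    F-cluster : ∀ {G} → G ∈ₗ C → Subset n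
    F-cluster G∈ = proj₁ (I.run-⊑ run G∈)

    F-cluster∈F : ∀ {G} (G∈ : G ∈ₗ C) → F-cluster G∈ ∈ₗ F
    F-cluster∈F G∈ = proj₁ (proj₂ (I.run-⊑ run G∈))

    ⊆F-cluster : ∀ {G} (G∈ : G ∈ₗ C) → G ⊆ F-cluster G∈
    ⊆F-cluster G∈ = proj₂ (proj₂ (I.run-⊑ run G∈))

    CsF Cs̄F : Subset n
    CsF = F-cluster Cs∈C
    Cs̄F = F-cluster Cs̄∈C

    CsF∈F : CsF ∈ₗ F
    CsF∈F = F-cluster∈F Cs∈C

    Cs̄F∈F : Cs̄F ∈ₗ F
    Cs̄F∈F = F-cluster∈F Cs̄∈C

    Cs⊆CsF : Cs ⊆ CsF
    Cs⊆CsF = ⊆F-cluster Cs∈C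

    Cs̄⊆Cs̄F : Cs̄ ⊆ Cs̄F
    Cs̄⊆Cs̄F = ⊆F-cluster Cs̄∈C

    active-CsF : I.Active i CsF
    active-CsF = active-s level i≤k (Cs⊆CsF s∈Cs)

    active-Cs̄F : I.Active i Cs̄F
    active-Cs̄F = active-s̄ level i≤k (Cs̄⊆Cs̄F s̄∈Cs̄)

    s∉F′ : ∀ {P} → P ∈ₗ F′ → s ∉ P
    s∉F′ P∈ s∈P = J-terminal⇒≢s (F′-terminal P∈ s∈P) refl

    s̄∉F′ : ∀ {P} → P ∈ₗ F′ → s̄ ∉ P
    s̄∉F′ P∈ s̄∈P = J-terminal⇒≢s̄ (F′-terminal P∈ s̄∈P) refl

    InsideF : Subset n → Set
    InsideF S = ∃[ G ] (G ∈ₗ F × S ⊆ G)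

    InsideF′ : Subset n → Set
    InsideF′ S = ∃[ P ] (P ∈ₗ F′ × S ⊆ P)

    -- A J-merge joining two clusters of F would be an I-merge still available in F.
    F′⊑F : F′ ⊑ F
    F′⊑F = J.run-invariant InsideF merge-inside run′ J-partition initial
      where
      initial : ∀ {P} → P ∈ₗ C′ → InsideF P
      initial P∈ with pieces P∈
      ... | inj₁ P⊆Cs = CsF , CsF∈F , Cs⊆CsF ∘ P⊆Cs
      ... | inj₂ (inj₁ P⊆Cs̄) = Cs̄F , Cs̄F∈F , Cs̄⊆Cs̄F ∘ P⊆Cs̄
      ... | inj₂ (inj₂ P∈C) = I.run-⊑ run P∈C
      merge-inside : J.Preserved i InsideF
      merge-inside {S₁ = S₁} {S₂} m cur⊑F = common (cur⊑F S₁∈C) (cur⊑F S₂∈C)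
        where
        open J.Merge m
        common : InsideF S₁ → InsideF S₂ → InsideF (S₁ ∪ S₂)
        common (G₁ , G₁∈ , S₁⊆G₁) (G₂ , G₂∈ , S₂⊆G₂) =
          let G , G∈ , S₁⊆G , S₂⊆G = I.stuck⇒common stuck G₁∈ G₂∈
                (active-J⇒I (J.IsPartition.terminal partition S₁∈C) S₁⊆G₁ active₁)
                (active-J⇒I (J.IsPartition.terminal partition S₂∈C) S₂⊆G₂ active₂)
                S₁⊆G₁ S₂⊆G₂ u∈S₁ v∈S₂ (within-⊑ cur⊑F close)
          in G , G∈ , ∪-lub S₁⊆G S₂⊆G

    active-F′ : ∀ {S P} → I.Active i S → P ∈ₗ F′ → S ⊆ P → J.Active i P
    active-F′ active-S P∈ S⊆P = active-I⇒J (F′-terminal P∈) S⊆P active-S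

    joint-F′ : ∀ {S₁ S₂ u v} → I.Active i S₁ → I.Active i S₂ → InsideF′ S₁ → InsideF′ S₂
               → u ∈ S₁ → v ∈ S₂ → Within F′ u v r₁ → InsideF′ (S₁ ∪ S₂)
    joint-F′ active₁ active₂ (P₁ , P₁∈ , S₁⊆P₁) (P₂ , P₂∈ , S₂⊆P₂) u∈S₁ v∈S₂ uv =
      let P , P∈ , S₁⊆P , S₂⊆P = J.stuck⇒common stuck′ P₁∈ P₂∈ (active-F′ active₁ P₁∈ S₁⊆P₁)
                                   (active-F′ active₂ P₂∈ S₂⊆P₂) S₁⊆P₁ S₂⊆P₂ u∈S₁ v∈S₂ uv
      in P , P∈ , ∪-lub S₁⊆P S₂⊆P

    merged-inside-F : ∀ {Cur S₁ S₂} → I.Merge i Cur S₁ S₂ → Cur ⊑ F → ∃[ G ] (G ∈ₗ F × S₁ ⊆ G × S₂ ⊆ G)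
    merged-inside-F m Cur⊑F =
      let G₁ , G₁∈ , S₁⊆G₁ = Cur⊑F S₁∈C
          G₂ , G₂∈ , S₂⊆G₂ = Cur⊑F S₂∈C
      in I.stuck⇒common stuck G₁∈ G₂∈ (I.active-⊆ S₁⊆G₁ active₁) (I.active-⊆ S₂⊆G₂ active₂)
           S₁⊆G₁ S₂⊆G₂ u∈S₁ v∈S₂ (within-⊑ Cur⊑F close)
      where open I.Merge m

    insideF′⇒insideF : ∀ {S} → InsideF′ S → InsideF S
    insideF′⇒insideF (P , P∈ , S⊆P) = let G , G∈ , P⊆G = F′⊑F P∈ in G , G∈ , P⊆G ∘ S⊆P

    -- Outside CsF and Cs̄F the I-run merges only within clusters of F′: the walk of
    -- such a merge either survives in M/F′, where F′ admits no merge, or after its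
    -- last edge lost inside CsF or Cs̄F it ends within r₁ of that cluster of F.
    data Placed (S : Subset n) : Set where
      in-CsF  : S ⊆ CsF → Placed S
      in-Cs̄F  : S ⊆ Cs̄F → Placed S
      in-F′   : InsideF′ S → Placed S

    placed⇒insideF : ∀ {S} → Placed S → InsideF S
    placed⇒insideF (in-CsF S⊆CsF) = CsF , CsF∈F , S⊆CsF
    placed⇒insideF (in-Cs̄F S⊆Cs̄F) = Cs̄F , Cs̄F∈F , S⊆Cs̄F
    placed⇒insideF (in-F′ inside) = insideF′⇒insideF inside

    by-cluster : ∀ {A : Set} G → (G ≡ CsF → A) → (G ≡ Cs̄F → A) → (G ≢ CsF → G ≢ Cs̄F → A) → A
    by-cluster G = ≟ₛ-cases G CsF Cs̄F

    placed-elsewhere : ∀ {G S} → G ∈ₗ F → G ≢ CsF → G ≢ Cs̄F → S ⊆ G → ∃[ x ] x ∈ S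
                       → Placed S → InsideF′ S
    placed-elsewhere G∈ G≢CsF _ S⊆G (x , x∈S) (in-CsF S⊆CsF) =
      ⊥-elim (G≢CsF (F-disjoint G∈ CsF∈F (S⊆G x∈S) (S⊆CsF x∈S)))
    placed-elsewhere G∈ _ G≢Cs̄F S⊆G (x , x∈S) (in-Cs̄F S⊆Cs̄F) =
      ⊥-elim (G≢Cs̄F (F-disjoint G∈ Cs̄F∈F (S⊆G x∈S) (S⊆Cs̄F x∈S)))
    placed-elsewhere _ _ _ _ _ (in-F′ inside) = inside

    InCsF : Fin n → Set
    InCsF z = z ∈ CsF ⊎ z ∈ Cs̄F

    placed⇒covered : ∀ {S} → Placed S → Covered F′ InCsF (λ _ → ⊥) ⊥ S
    placed⇒covered (in-CsF S⊆CsF) = inside-X (inj₁ ∘ S⊆CsF)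
    placed⇒covered (in-Cs̄F S⊆Cs̄F) = inside-X (inj₂ ∘ S⊆Cs̄F)
    placed⇒covered (in-F′ (P , P∈ , S⊆P)) = inside-B P∈ S⊆P

    module MergePlaced {Cur S₁ S₂} (m : I.Merge i Cur S₁ S₂) (placed : ∀ {S} → S ∈ₗ Cur → Placed S) where
      open I.Merge m

      module _ {G} (G∈ : G ∈ₗ F) (S₁⊆G : S₁ ⊆ G) (S₂⊆G : S₂ ⊆ G)
               (G≢CsF : G ≢ CsF) (G≢Cs̄F : G ≢ Cs̄F) where
        inside : ∀ {S} → S ∈ₗ Cur → S ⊆ G → InsideF′ S
        inside S∈ S⊆G =
          placed-elsewhere G∈ G≢CsF G≢Cs̄F S⊆G (I.IsPartition.nonempty partition S∈) (placed S∈)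

        active-G : I.Active i G
        active-G = I.active-⊆ S₁⊆G active₁

        not-near-S₂ : ∀ {H p} → H ∈ₗ F → I.Active i H → G ≢ H → p ∈ H → ¬ Within F′ p v r₁
        not-near-S₂ H∈ active-H G≢H p∈H pv =
          G≢H (≡.sym (F-same H∈ G∈ active-H active-G p∈H (S₂⊆G v∈S₂) (within-⊑ F′⊑F pv)))

        joined-in-F′ : InsideF′ (S₁ ∪ S₂)
        joined-in-F′ = link (inside S₁∈C S₁⊆G) (inside S₂∈C S₂⊆G) (exit (placed⇒covered ∘ placed) close)
          where
          link : InsideF′ S₁ → InsideF′ S₂ → Exit F′ InCsF (λ _ → ⊥) ⊥ u v r₁ → InsideF′ (S₁ ∪ S₂)
          link inside₁ inside₂ (direct uv) = joint-F′ active₁ active₂ inside₁ inside₂ u∈S₁ v∈S₂ uv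
          link _ _ (near-X (inj₁ p∈CsF) pv) = ⊥-elim (not-near-S₂ CsF∈F active-CsF G≢CsF p∈CsF pv)
          link _ _ (near-X (inj₂ p∈Cs̄F) pv) = ⊥-elim (not-near-S₂ Cs̄F∈F active-Cs̄F G≢Cs̄F p∈Cs̄F pv)
          link _ _ (near-Y () _)
          link _ _ (bridge _ () _)
          link _ _ (other ())

      placed-∪ : Placed (S₁ ∪ S₂)
      placed-∪ = place (merged-inside-F m (placed⇒insideF ∘ placed))
        where
        place : ∃[ G ] (G ∈ₗ F × S₁ ⊆ G × S₂ ⊆ G) → Placed (S₁ ∪ S₂)
        place (G , G∈ , S₁⊆G , S₂⊆G) =
          by-cluster G (λ { refl → in-CsF (∪-lub S₁⊆G S₂⊆G) }) (λ { refl → in-Cs̄F (∪-lub S₁⊆G S₂⊆G) })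
            λ G≢CsF G≢Cs̄F → in-F′ (joined-in-F′ G∈ S₁⊆G S₂⊆G G≢CsF G≢Cs̄F)

    placed-F : ∀ {G} → G ∈ₗ F → Placed G
    placed-F = I.run-invariant Placed MergePlaced.placed-∪ run I-partition initial
      where
      initial : ∀ {G} → G ∈ₗ C → Placed G
      initial {G} G∈ = decide (s ∈? G) (s̄ ∈? G)
        where
        decide : Dec (s ∈ G) → Dec (s̄ ∈ G) → Placed G
        decide (yes s∈G) _ =
          in-CsF (subst (_⊆ CsF) (≡.sym (C-disjoint G∈ Cs∈C s∈G s∈Cs)) Cs⊆CsF)
        decide (no _) (yes s̄∈G) =
          in-Cs̄F (subst (_⊆ Cs̄F) (≡.sym (C-disjoint G∈ Cs̄∈C s̄∈G s̄∈Cs̄)) Cs̄⊆Cs̄F)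
        decide (no s∉G) (no s̄∉G) = in-F′ (J.run-⊑ run′ (untouched G∈ s∉G s̄∉G))

    untouched-F : ∀ {G} → G ∈ₗ F → G ≢ CsF → G ≢ Cs̄F → G ∈ₗ F′
    untouched-F {G} G∈ G≢CsF G≢Cs̄F =
      equal (placed-elsewhere G∈ G≢CsF G≢Cs̄F (λ x∈ → x∈) (F-nonempty G∈) (placed-F G∈))
      where
      equal : InsideF′ G → G ∈ₗ F′
      equal (P , P∈ , G⊆P) =
        let H , H∈ , P⊆H = F′⊑F P∈
            x , x∈G = F-nonempty G∈
            P⊆G = subst (P ⊆_) (≡.sym (F-disjoint G∈ H∈ x∈G (P⊆H (G⊆P x∈G)))) P⊆H
        in subst (_∈ₗ F′) (⊆-antisym P⊆G G⊆P) P∈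

    pieces-F : ∀ {P} → P ∈ₗ F′ → P ⊆ CsF ⊎ P ⊆ Cs̄F ⊎ P ∈ₗ F
    pieces-F {P} P∈ = classify (F′⊑F P∈)
      where
      classify : InsideF P → P ⊆ CsF ⊎ P ⊆ Cs̄F ⊎ P ∈ₗ F
      classify (G , G∈ , P⊆G) = by-cluster {A = P ⊆ CsF ⊎ P ⊆ Cs̄F ⊎ P ∈ₗ F} G
        (λ { refl → inj₁ P⊆G }) (λ { refl → inj₂ (inj₁ P⊆G) })
        λ G≢CsF G≢Cs̄F → let x , x∈P = F′-nonempty P∈ in
          inj₂ (inj₂ (subst (_∈ₗ F) (≡.sym (F′-disjoint P∈ (untouched-F G∈ G≢CsF G≢Cs̄F) x∈P (P⊆G x∈P))) G∈))

    r₁+r₁≡r₂ : r₁ + r₁ ≡ r₂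
    r₁+r₁≡r₂ = ≡.sym (pow2-suc (suc i))

    r₂+r₂≡r₃ : r₂ + r₂ ≡ r₃
    r₂+r₂≡r₃ = ≡.sym (pow2-suc (suc (suc i)))

    r₁≤r₂ : r₁ ≤ r₂
    r₁≤r₂ = pow2-mono-≤ (ℕ.n≤1+n (suc i))

    r₂≤r₃ : r₂ ≤ r₃
    r₂≤r₃ = pow2-mono-≤ (ℕ.n≤1+n (suc (suc i)))

    -- A step of length r₁ from a point of an active cluster of F′ into an active
    -- cluster stays in that cluster, so the bound r₂ does not grow along merges.
    data Reach (a v : Fin n) : Set where
      near : Within F′ a v r₁ → Reach a v
      far  : Within F′ a v r₂ → ∀ {P} → P ∈ₗ F′ → v ∈ P → J.Active i P → Reach a v

    reach-bound : ∀ {a v} → Reach a v → Within F′ a v r₂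
    reach-bound (near av) = within-weaken av r₁≤r₂
    reach-bound (far av _ _ _) = av

    reach-step : ∀ {a p y P} → Reach a p → Within F′ p y r₁ → P ∈ₗ F′ → y ∈ P → J.Active i P → Reach a y
    reach-step (near ap) py P∈ y∈P active-P =
      far (within-weaken (within-trans ap py) (ℚ.≤-reflexive r₁+r₁≡r₂)) P∈ y∈P active-P
    reach-step {a} {p} {y} {P} (far ap W∈ p∈W active-W) py P∈ y∈P active-P =
      same (F′-same W∈ P∈ active-W active-P p∈W y∈P py)
      where
      same : _ ≡ P → Reach a y
      same refl = far (within-cluster ap P∈ p∈W y∈P) P∈ y∈P active-P

    reach-cluster : ∀ {a y w P} → Reach a y → P ∈ₗ F′ → y ∈ P → J.Active i P → w ∈ P → Reach a w
    reach-cluster (near ay) P∈ y∈P _ w∈P = near (within-cluster ay P∈ y∈P w∈P)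
    reach-cluster (far ay _ _ _) P∈ y∈P active-P w∈P = far (within-cluster ay P∈ y∈P w∈P) P∈ w∈P active-P

    spread : ∀ {a S P x} → I.Active i S → P ∈ₗ F′ → S ⊆ P → x ∈ S → Reach a x → ∀ {w} → w ∈ S → Reach a w
    spread active-S P∈ S⊆P x∈S reach-x w∈S =
      reach-cluster reach-x P∈ (S⊆P x∈S) (active-F′ active-S P∈ S⊆P) (S⊆P w∈S)

    -- The separated case for the endpoint a; o is the other endpoint.
    module Side (a o : Fin n) {Ca Co : Subset n}
                (Ca∈C : Ca ∈ₗ C) (a∈Ca : a ∈ Ca) (Co∈C : Co ∈ₗ C) (o∈Co : o ∈ Co)
                (CaF≢CoF : F-cluster Ca∈C ≢ F-cluster Co∈C)
                (active-a : I.Active i (F-cluster Ca∈C)) (active-o : I.Active i (F-cluster Co∈C))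
                (a∉F′ : ∀ {P} → P ∈ₗ F′ → a ∉ P)
                (untouched-C : ∀ {G} → G ∈ₗ C → a ∉ G → o ∉ G → G ∈ₗ C′)
                (elsewhere : ∀ {G} → G ∈ₗ F → G ≢ F-cluster Ca∈C → G ≢ F-cluster Co∈C → G ∈ₗ F′)
                (reach-Ca : ∀ {v} → v ∈ Ca → Within C′ a v r₁) where
      CaF CoF : Subset n
      CaF = F-cluster Ca∈C
      CoF = F-cluster Co∈C

      CaF∈F : CaF ∈ₗ F
      CaF∈F = F-cluster∈F Ca∈C

      CoF∈F : CoF ∈ₗ F
      CoF∈F = F-cluster∈F Co∈C

      Ca⊆CaF : Ca ⊆ CaF
      Ca⊆CaF = ⊆F-cluster Ca∈C

      Co⊆CoF : Co ⊆ CoF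
      Co⊆CoF = ⊆F-cluster Co∈C

      data Sided (S : Subset n) : Set where
        reached  : S ⊆ CaF → (∀ {v} → v ∈ S → Reach a v) → Sided S
        opposite : S ⊆ CoF → Sided S
        in-F′    : InsideF′ S → Sided S

      sided⇒insideF : ∀ {S} → Sided S → InsideF S
      sided⇒insideF (reached S⊆CaF _) = CaF , CaF∈F , S⊆CaF
      sided⇒insideF (opposite S⊆CoF) = CoF , CoF∈F , S⊆CoF
      sided⇒insideF (in-F′ inside) = insideF′⇒insideF inside

      Reached : Fin n → Set
      Reached z = z ∈ CaF × Reach a z

      sided⇒covered : ∀ {S} → Sided S → Covered F′ Reached (_∈ CoF) ⊥ S
      sided⇒covered (reached S⊆CaF reach) = inside-X λ z∈ → S⊆CaF z∈ , reach z∈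
      sided⇒covered (opposite S⊆CoF) = inside-Y S⊆CoF
      sided⇒covered (in-F′ (P , P∈ , S⊆P)) = inside-B P∈ S⊆P

      CaF-CoF-apart : ∀ {p q} → p ∈ CaF → q ∈ CoF → ¬ Within F′ p q r₁
      CaF-CoF-apart p∈ q∈ pq = CaF≢CoF (F-same CaF∈F CoF∈F active-a active-o p∈ q∈ (within-⊑ F′⊑F pq))

      arrive : ∀ {x y} → Exit F′ Reached (_∈ CoF) ⊥ x y r₁ → y ∈ CaF → ∀ {Q} → Q ∈ₗ F′ → y ∈ Q
               → J.Active i Q → Within F′ x y r₁ ⊎ Reach a y
      arrive (direct xy) _ _ _ _ = inj₁ xy
      arrive (near-X (_ , ap) py) _ Q∈ y∈Q active-Q = inj₂ (reach-step ap py Q∈ y∈Q active-Q)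
      arrive (near-Y q∈CoF qy) y∈CaF _ _ _ = ⊥-elim (CaF-CoF-apart y∈CaF q∈CoF (within-sym qy))
      arrive (bridge (p∈CaF , _) q∈CoF pq) _ _ _ _ = ⊥-elim (CaF-CoF-apart p∈CaF q∈CoF pq)
      arrive (other ())

      module MergeSided {Cur S₁ S₂} (m : I.Merge i Cur S₁ S₂) (sided : ∀ {S} → S ∈ₗ Cur → Sided S) where
        open I.Merge m

        not-opposite : ∀ {S} → S ∈ₗ Cur → S ⊆ CaF → ¬ S ⊆ CoF
        not-opposite S∈ S⊆CaF S⊆CoF = let x , x∈S = I.IsPartition.nonempty partition S∈ in
          CaF≢CoF (F-disjoint CaF∈F CoF∈F (S⊆CaF x∈S) (S⊆CoF x∈S))

        module _ (S₁⊆CaF : S₁ ⊆ CaF) (S₂⊆CaF : S₂ ⊆ CaF) where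
          forward : ∀ {P} → P ∈ₗ F′ → S₂ ⊆ P → Within F′ u v r₁ ⊎ Reach a v
          forward P∈ S₂⊆P = arrive (exit (sided⇒covered ∘ sided) close) (S₂⊆CaF v∈S₂) P∈ (S₂⊆P v∈S₂)
            (active-F′ active₂ P∈ S₂⊆P)

          backward : ∀ {P} → P ∈ₗ F′ → S₁ ⊆ P → Within F′ v u r₁ ⊎ Reach a u
          backward P∈ S₁⊆P = arrive (exit (sided⇒covered ∘ sided) (within-sym close)) (S₁⊆CaF u∈S₁) P∈
            (S₁⊆P u∈S₁) (active-F′ active₁ P∈ S₁⊆P)

          combine : Sided S₁ → Sided S₂ → Sided (S₁ ∪ S₂)
          combine (opposite S₁⊆CoF) _ = ⊥-elim (not-opposite S₁∈C S₁⊆CaF S₁⊆CoF)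
          combine _ (opposite S₂⊆CoF) = ⊥-elim (not-opposite S₂∈C S₂⊆CaF S₂⊆CoF)
          combine (reached _ reach₁) (reached _ reach₂) =
            reached (∪-lub S₁⊆CaF S₂⊆CaF) (∪-lub reach₁ reach₂)
          combine (reached _ reach₁) (in-F′ (P₂ , P₂∈ , S₂⊆P₂)) =
            reached (∪-lub S₁⊆CaF S₂⊆CaF) (∪-lub reach₁ (spread active₂ P₂∈ S₂⊆P₂ v∈S₂ reach-v))
            where
            reach-v : Reach a v
            reach-v = [ (λ uv → reach-step (reach₁ u∈S₁) uv P₂∈ (S₂⊆P₂ v∈S₂) (active-F′ active₂ P₂∈ S₂⊆P₂))
                      , (λ r → r) ] (forward P₂∈ S₂⊆P₂)
          combine (in-F′ (P₁ , P₁∈ , S₁⊆P₁)) (reached _ reach₂) =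
            reached (∪-lub S₁⊆CaF S₂⊆CaF) (∪-lub (spread active₁ P₁∈ S₁⊆P₁ u∈S₁ reach-u) reach₂)
            where
            reach-u : Reach a u
            reach-u = [ (λ vu → reach-step (reach₂ v∈S₂) vu P₁∈ (S₁⊆P₁ u∈S₁) (active-F′ active₁ P₁∈ S₁⊆P₁))
                      , (λ r → r) ] (backward P₁∈ S₁⊆P₁)
          combine (in-F′ inside₁@(P₁ , P₁∈ , S₁⊆P₁)) (in-F′ inside₂@(P₂ , P₂∈ , S₂⊆P₂)) =
            both (backward P₁∈ S₁⊆P₁) (forward P₂∈ S₂⊆P₂)
            where
            both : Within F′ v u r₁ ⊎ Reach a u → Within F′ u v r₁ ⊎ Reach a v → Sided (S₁ ∪ S₂)
            both (inj₁ vu) _ = in-F′ (joint-F′ active₁ active₂ inside₁ inside₂ u∈S₁ v∈S₂ (within-sym vu))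
            both _ (inj₁ uv) = in-F′ (joint-F′ active₁ active₂ inside₁ inside₂ u∈S₁ v∈S₂ uv)
            both (inj₂ reach-u) (inj₂ reach-v) = reached (∪-lub S₁⊆CaF S₂⊆CaF)
              (∪-lub (spread active₁ P₁∈ S₁⊆P₁ u∈S₁ reach-u) (spread active₂ P₂∈ S₂⊆P₂ v∈S₂ reach-v))

        sided-∪ : Sided (S₁ ∪ S₂)
        sided-∪ = place (merged-inside-F m (sided⇒insideF ∘ sided))
          where
          place : ∃[ G ] (G ∈ₗ F × S₁ ⊆ G × S₂ ⊆ G) → Sided (S₁ ∪ S₂)
          place (G , G∈ , S₁⊆G , S₂⊆G) =
            ≟ₛ-cases G CaF CoF (λ { refl → combine S₁⊆G S₂⊆G (sided S₁∈C) (sided S₂∈C) })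
              (λ { refl → opposite (∪-lub S₁⊆G S₂⊆G) })
              λ G≢CaF G≢CoF → in-F′ (G , elsewhere G∈ G≢CaF G≢CoF , ∪-lub S₁⊆G S₂⊆G)

      sided-F : ∀ {G} → G ∈ₗ F → Sided G
      sided-F = I.run-invariant Sided MergeSided.sided-∪ run I-partition initial
        where
        initial : ∀ {G} → G ∈ₗ C → Sided G
        initial {G} G∈ = decide (a ∈? G) (o ∈? G)
          where
          decide : Dec (a ∈ G) → Dec (o ∈ G) → Sided G
          decide (yes a∈G) _ = subst Sided (≡.sym (C-disjoint G∈ Ca∈C a∈G a∈Ca))
            (reached Ca⊆CaF (λ v∈ → near (within-⊑ (J.run-⊑ run′) (reach-Ca v∈))))
          decide (no _) (yes o∈G) = subst Sided (≡.sym (C-disjoint G∈ Co∈C o∈G o∈Co))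
            (opposite Co⊆CoF)
          decide (no a∉G) (no o∉G) = in-F′ (J.run-⊑ run′ (untouched-C G∈ a∉G o∉G))

      reach-CaF : ∀ {v} → v ∈ CaF → Within F′ a v r₂
      reach-CaF {v} v∈ = final (sided-F CaF∈F)
        where
        a∈CaF : a ∈ CaF
        a∈CaF = Ca⊆CaF a∈Ca
        final : Sided CaF → Within F′ a v r₂
        final (reached _ reach) = reach-bound (reach v∈)
        final (opposite CaF⊆CoF) = ⊥-elim (CaF≢CoF (F-disjoint CaF∈F CoF∈F a∈CaF (CaF⊆CoF a∈CaF)))
        final (in-F′ (P , P∈ , CaF⊆P)) = ⊥-elim (a∉F′ P∈ (CaF⊆P a∈CaF))

    separated-F : CsF ≢ Cs̄F → (∀ {v} → v ∈ CsF → Within F′ s v r₂)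
                             × (∀ {v} → v ∈ Cs̄F → Within F′ s̄ v r₂)
    separated-F CsF≢Cs̄F =
      Side.reach-CaF s s̄ Cs∈C s∈Cs Cs̄∈C s̄∈Cs̄ CsF≢Cs̄F active-CsF active-Cs̄F
        s∉F′ untouched untouched-F (proj₁ (separated Cs≢Cs̄)) ,
      Side.reach-CaF s̄ s Cs̄∈C s̄∈Cs̄ Cs∈C s∈Cs (CsF≢Cs̄F ∘ ≡.sym) active-Cs̄F active-CsF
        s̄∉F′ (λ G∈ s̄∉G s∉G → untouched G∈ s∉G s̄∉G) (λ G∈ G≢Cs̄F G≢CsF → untouched-F G∈ G≢CsF G≢Cs̄F)
        (proj₂ (separated Cs≢Cs̄))
      where
      Cs≢Cs̄ : Cs ≢ Cs̄
      Cs≢Cs̄ Cs≡Cs̄ =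
        CsF≢Cs̄F (F-disjoint CsF∈F Cs̄F∈F (Cs⊆CsF (subst (s̄ ∈_) (≡.sym Cs≡Cs̄) s̄∈Cs̄)) (Cs̄⊆Cs̄F s̄∈Cs̄))

    Done : Set
    Done = Within F′ s s̄ r₃

    cross : ∀ {p q} → Reach s p → Reach s̄ q → Within F′ p q r₁ → Done
    cross (near sp) (near s̄q) pq =
      within-weaken (within-trans (within-trans sp pq) (within-sym s̄q)) 3r₁≤r₃
      where
      3r₁≤r₃ : (r₁ + r₁) + r₁ ≤ r₃
      3r₁≤r₃ = ℚ.≤-trans (ℚ.≤-reflexive (cong (_+ r₁) r₁+r₁≡r₂))
                 (ℚ.≤-trans (ℚ.+-monoʳ-≤ r₂ r₁≤r₂) (ℚ.≤-reflexive r₂+r₂≡r₃))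
    cross sp (far s̄q Q∈ q∈Q active-Q) pq = meet (reach-bound (reach-step sp pq Q∈ q∈Q active-Q)) s̄q
      where
      meet : ∀ {x} → Within F′ s x r₂ → Within F′ s̄ x r₂ → Done
      meet sx s̄x = within-weaken (within-trans sx (within-sym s̄x)) (ℚ.≤-reflexive r₂+r₂≡r₃)
    cross (far sp P∈ p∈P active-P) s̄q pq =
      within-weaken
        (within-trans sp (within-sym (reach-bound (reach-step s̄q (within-sym pq) P∈ p∈P active-P))))
        (ℚ.≤-reflexive r₂+r₂≡r₃)

    -- `done` carries the conclusion of the joined case through the remaining merges.
    data Status (S : Subset n) : Set where
      done   : Done → Status S
      from-s : (∀ {v} → v ∈ S → Reach s v) → Status S
      from-s̄ : (∀ {v} → v ∈ S → Reach s̄ v) → Status S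

    data Tracked (S : Subset n) : Set where
      settled : Status S → Tracked S
      in-F′   : InsideF′ S → Tracked S

    tracked⇒covered : ∀ {S} → Tracked S → Covered F′ (Reach s) (Reach s̄) Done S
    tracked⇒covered (settled (done d)) = other d
    tracked⇒covered (settled (from-s reach)) = inside-X reach
    tracked⇒covered (settled (from-s̄ reach)) = inside-Y reach
    tracked⇒covered (in-F′ (P , P∈ , S⊆P)) = inside-B P∈ S⊆P

    extend : ∀ {S T x y} → Status S → x ∈ S → I.Active i T → InsideF′ T → y ∈ T
             → Within F′ x y r₁ → Status T
    extend (done d) _ _ _ _ _ = done d
    extend (from-s reach) x∈S active-T (P , P∈ , T⊆P) y∈T xy =
      from-s (spread active-T P∈ T⊆P y∈T (reach-step (reach x∈S) xy P∈ (T⊆P y∈T) (active-F′ active-T P∈ T⊆P)))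
    extend (from-s̄ reach) x∈S active-T (P , P∈ , T⊆P) y∈T xy =
      from-s̄ (spread active-T P∈ T⊆P y∈T (reach-step (reach x∈S) xy P∈ (T⊆P y∈T) (active-F′ active-T P∈ T⊆P)))

    module MergeTracked {Cur S₁ S₂} (m : I.Merge i Cur S₁ S₂)
                        (tracked : ∀ {S} → S ∈ₗ Cur → Tracked S) where
      open I.Merge m

      covered : ∀ {S} → S ∈ₗ Cur → Covered F′ (Reach s) (Reach s̄) Done S
      covered = tracked⇒covered ∘ tracked

      mixed : ∀ {x y} → Reach s x → Reach s̄ y → Within Cur x y r₁ → Done
      mixed {y = y} reach-x reach-y xy = from (exit-from covered reach-x xy)
        where
        from : ExitFrom F′ (Reach s) (Reach s̄) Done y r₁ → Done
        from (near-X reach-p py) = cross reach-p reach-y py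
        from (bridge reach-p reach-q pq) = cross reach-p reach-q pq
        from (other d) = d

      arrive : ∀ {x y S} → Within Cur x y r₁ → I.Active i S → InsideF′ S → y ∈ S
               → Within F′ x y r₁ ⊎ Status S
      arrive {x} {y} {S} xy active-S (P , P∈ , S⊆P) y∈S = from (exit covered xy)
        where
        active-P : J.Active i P
        active-P = active-F′ active-S P∈ S⊆P
        from : Exit F′ (Reach s) (Reach s̄) Done x y r₁ → Within F′ x y r₁ ⊎ Status S
        from (direct xy′) = inj₁ xy′
        from (near-X reach-p py) =
          inj₂ (from-s (spread active-S P∈ S⊆P y∈S (reach-step reach-p py P∈ (S⊆P y∈S) active-P)))
        from (near-Y reach-q qy) =
          inj₂ (from-s̄ (spread active-S P∈ S⊆P y∈S (reach-step reach-q qy P∈ (S⊆P y∈S) active-P)))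
        from (bridge reach-p reach-q pq) = inj₂ (done (cross reach-p reach-q pq))
        from (other d) = inj₂ (done d)

      status-∪ : Status S₁ → Status S₂ → Status (S₁ ∪ S₂)
      status-∪ (done d) _ = done d
      status-∪ _ (done d) = done d
      status-∪ (from-s reach₁) (from-s reach₂) = from-s (∪-lub reach₁ reach₂)
      status-∪ (from-s̄ reach₁) (from-s̄ reach₂) = from-s̄ (∪-lub reach₁ reach₂)
      status-∪ (from-s reach₁) (from-s̄ reach₂) = done (mixed (reach₁ u∈S₁) (reach₂ v∈S₂) close)
      status-∪ (from-s̄ reach₁) (from-s reach₂) =
        done (mixed (reach₂ v∈S₂) (reach₁ u∈S₁) (within-sym close))

      status₂ : Status S₁ → InsideF′ S₂ → Status S₂
      status₂ σ₁ inside₂ = [ extend σ₁ u∈S₁ active₂ inside₂ v∈S₂ , (λ σ₂ → σ₂) ]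
                             (arrive close active₂ inside₂ v∈S₂)

      status₁ : InsideF′ S₁ → Status S₂ → Status S₁
      status₁ inside₁ σ₂ = [ extend σ₂ v∈S₂ active₁ inside₁ u∈S₁ , (λ σ₁ → σ₁) ]
                             (arrive (within-sym close) active₁ inside₁ u∈S₁)

      tracked-∪ : Tracked (S₁ ∪ S₂)
      tracked-∪ = combine (tracked S₁∈C) (tracked S₂∈C)
        where
        combine : Tracked S₁ → Tracked S₂ → Tracked (S₁ ∪ S₂)
        combine (settled σ₁) (settled σ₂) = settled (status-∪ σ₁ σ₂)
        combine (settled σ₁) (in-F′ inside₂) = settled (status-∪ σ₁ (status₂ σ₁ inside₂))
        combine (in-F′ inside₁) (settled σ₂) = settled (status-∪ (status₁ inside₁ σ₂) σ₂)
        combine (in-F′ inside₁) (in-F′ inside₂) =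
          [ (λ vu → in-F′ (joint-F′ active₁ active₂ inside₁ inside₂ u∈S₁ v∈S₂ (within-sym vu)))
          , (λ σ₁ → settled (status-∪ σ₁ (status₂ σ₁ inside₂))) ]
          (arrive (within-sym close) active₁ inside₁ u∈S₁)

    joined-F : CsF ≡ Cs̄F → Done
    joined-F CsF≡Cs̄F = decide (Cs ≟ₛ Cs̄)
      where
      s∈CsF : s ∈ CsF
      s∈CsF = Cs⊆CsF s∈Cs

      s̄∈CsF : s̄ ∈ CsF
      s̄∈CsF = subst (s̄ ∈_) (≡.sym CsF≡Cs̄F) (Cs̄⊆Cs̄F s̄∈Cs̄)

      initial : Cs ≢ Cs̄ → ∀ {G} → G ∈ₗ C → Tracked G
      initial Cs≢Cs̄ {G} G∈ = at (s ∈? G) (s̄ ∈? G)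
        where
        at : Dec (s ∈ G) → Dec (s̄ ∈ G) → Tracked G
        at (yes s∈G) _ = subst Tracked (≡.sym (C-disjoint G∈ Cs∈C s∈G s∈Cs))
          (settled (from-s (λ v∈ → near (within-⊑ (J.run-⊑ run′) (proj₁ (separated Cs≢Cs̄) v∈)))))
        at (no _) (yes s̄∈G) = subst Tracked (≡.sym (C-disjoint G∈ Cs̄∈C s̄∈G s̄∈Cs̄))
          (settled (from-s̄ (λ v∈ → near (within-⊑ (J.run-⊑ run′) (proj₂ (separated Cs≢Cs̄) v∈)))))
        at (no s∉G) (no s̄∉G) = in-F′ (J.run-⊑ run′ (untouched G∈ s∉G s̄∉G))

      final : Tracked CsF → Done
      final (settled (done d)) = d
      final (settled (from-s reach)) = within-weaken (reach-bound (reach s̄∈CsF)) r₂≤r₃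
      final (settled (from-s̄ reach)) = within-weaken (within-sym (reach-bound (reach s∈CsF))) r₂≤r₃
      final (in-F′ (P , P∈ , CsF⊆P)) = ⊥-elim (s∉F′ P∈ (CsF⊆P s∈CsF))

      decide : Dec (Cs ≡ Cs̄) → Done
      decide (yes Cs≡Cs̄) = within-weaken (within-⊑ (J.run-⊑ run′) (joined Cs≡Cs̄)) r₂≤r₃
      decide (no Cs≢Cs̄) =
        final (I.run-invariant Tracked MergeTracked.tracked-∪ run I-partition (initial Cs≢Cs̄) CsF∈F)

    invariant-next : Invariant (suc i) F F′
    invariant-next = record
      { I-partition = partition-F
      ; J-partition = partition-F′
      ; Cs = CsF ; Cs̄ = Cs̄F
      ; Cs∈C = CsF∈F ; s∈Cs = Cs⊆CsF s∈Cs
      ; Cs̄∈C = Cs̄F∈F ; s̄∈Cs̄ = Cs̄⊆Cs̄F s̄∈Cs̄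
      ; untouched = λ G∈ s∉G s̄∉G →
          untouched-F G∈ (λ { refl → s∉G (Cs⊆CsF s∈Cs) }) (λ { refl → s̄∉G (Cs̄⊆Cs̄F s̄∈Cs̄) })
      ; pieces = pieces-F
      ; separated = separated-F
      ; joined = joined-F
      }

  invariant : ∀ {i k C C′} → Level (d s s̄) k → i ℕ.≤ k → I.StartOf i C → J.StartOf i C′
              → Invariant i C C′
  invariant _ _ I.start J.start = invariant-start
  invariant level i<k (I.next before run stuck) (J.next before′ run′ stuck′) =
    Stage.invariant-next level (ℕ.<⇒≤ i<k) (invariant level (ℕ.<⇒≤ i<k) before before′)
      run stuck run′ stuck′

  clusters-of-mates : ∀ {i C C′} (inv : Invariant i C C′) → let open Invariant inv in
                      ∀ {G H} → G ∈ₗ C → s ∈ G → H ∈ₗ C → s̄ ∈ H → G ≡ Cs × H ≡ Cs̄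
  clusters-of-mates inv G∈ s∈G H∈ s̄∈H =
    disjoint G∈ Cs∈C s∈G s∈Cs , disjoint H∈ Cs̄∈C s̄∈H s̄∈Cs̄
    where
    open Invariant inv
    open I.IsPartition I-partition

  module Enumeration {i C C′} (inv : Invariant i C C′) where
    open Invariant inv
    open I.IsPartition I-partition using ()
      renaming (nonempty to C-nonempty; disjoint to C-disjoint; unique to C-unique; terminal to C-terminal)
    open J.IsPartition J-partition using ()
      renaming (unique to C′-unique; terminal to C′-terminal; covering to C′-covering)

    s∉C′ : ∀ {P} → P ∈ₗ C′ → s ∉ P
    s∉C′ P∈ s∈P = J-terminal⇒≢s (C′-terminal P∈ s∈P) refl

    s̄∉C′ : ∀ {P} → P ∈ₗ C′ → s̄ ∉ P
    s̄∉C′ P∈ s̄∈P = J-terminal⇒≢s̄ (C′-terminal P∈ s̄∈P) refl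

    ⊈-other : ∀ {G H} → G ∈ₗ C → H ∈ₗ C → G ≢ H → ¬ G ⊆ H
    ⊈-other G∈ H∈ G≢H G⊆H = let x , x∈G = C-nonempty G∈ in G≢H (C-disjoint G∈ H∈ x∈G (G⊆H x∈G))

    piece-⊆ : ∀ {G P x} → G ∈ₗ C → P ∈ₗ C′ → x ∈ P → x ∈ G → P ⊆ G
    piece-⊆ {G} {P} {x} G∈ P∈ x∈P x∈G = from (pieces P∈)
      where
      from : P ⊆ Cs ⊎ P ⊆ Cs̄ ⊎ P ∈ₗ C → P ⊆ G
      from (inj₁ P⊆Cs) = subst (P ⊆_) (C-disjoint Cs∈C G∈ (P⊆Cs x∈P) x∈G) P⊆Cs
      from (inj₂ (inj₁ P⊆Cs̄)) = subst (P ⊆_) (C-disjoint Cs̄∈C G∈ (P⊆Cs̄ x∈P) x∈G) P⊆Cs̄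
      from (inj₂ (inj₂ P∈C)) = subst (P ⊆_) (C-disjoint P∈C G∈ x∈P x∈G) (λ y∈ → y∈)

    covered-by-pieces : ∀ {G x} → G ∈ₗ C → x ∈ G → x ≡ s ⊎ x ≡ s̄ ⊎ ∃[ P ] (P ∈ₗ C′ × x ∈ P × P ⊆ G)
    covered-by-pieces {G} {x} G∈ x∈G = from (I-terminal⁻ (C-terminal G∈ x∈G))
      where
      from : J.Terminal x ⊎ x ≡ s ⊎ x ≡ s̄ → x ≡ s ⊎ x ≡ s̄ ⊎ ∃[ P ] (P ∈ₗ C′ × x ∈ P × P ⊆ G)
      from (inj₁ x∈J) = let P , P∈ , x∈P = C′-covering x∈J in
        inj₂ (inj₂ (P , P∈ , x∈P , piece-⊆ G∈ P∈ x∈P x∈G))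
      from (inj₂ (inj₁ x≡s)) = inj₁ x≡s
      from (inj₂ (inj₂ x≡s̄)) = inj₂ (inj₁ x≡s̄)

    not-mates : ∀ {G} → G ∈ₗ C → G ≢ Cs → G ≢ Cs̄ → G ∈ₗ C′
    not-mates G∈ G≢Cs G≢Cs̄ =
      untouched G∈ (λ s∈G → G≢Cs (C-disjoint G∈ Cs∈C s∈G s∈Cs)) (λ s̄∈G → G≢Cs̄ (C-disjoint G∈ Cs̄∈C s̄∈G s̄∈Cs̄))

    module Separated (Cs≢Cs̄ : Cs ≢ Cs̄) where
      rest A B R : List (Subset n)
      rest = filter (∁? (_⊆? Cs)) C′
      A = filter (_⊆? Cs) C′
      B = filter (_⊆? Cs̄) rest
      R = filter (∁? (_⊆? Cs̄)) rest

      A++B++R↭C′ : A ++ B ++ R ↭ C′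
      A++B++R↭C′ = ↭-sym (↭-trans (↭-filter-∁ (_⊆? Cs) C′) (++⁺ˡ A (↭-filter-∁ (_⊆? Cs̄) rest)))

      ∈R⁻ : ∀ {P} → P ∈ₗ R → P ∈ₗ C′ × ¬ P ⊆ Cs × ¬ P ⊆ Cs̄
      ∈R⁻ P∈ = let P∈rest , P⊈Cs̄ = ∈-filter⁻ (∁? (_⊆? Cs̄)) P∈
                   P∈C′ , P⊈Cs = ∈-filter⁻ (∁? (_⊆? Cs)) P∈rest
               in P∈C′ , P⊈Cs , P⊈Cs̄

      Cs∩Cs̄ : ∀ {x} → x ∈ Cs → x ∉ Cs̄
      Cs∩Cs̄ x∈Cs x∈Cs̄ = Cs≢Cs̄ (C-disjoint Cs∈C Cs̄∈C x∈Cs x∈Cs̄)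

      Cs≡ : Cs ≡ ⁅ s ⁆ ∪ ⋃ A
      Cs≡ = ≡-∪-⋃ A (⁅⁆-⊆ s∈Cs) (λ P∈ → proj₂ (∈-filter⁻ (_⊆? Cs) {xs = C′} P∈)) cover
        where
        cover : ∀ {x} → x ∈ Cs → x ∈ ⁅ s ⁆ ⊎ ∃[ P ] (P ∈ₗ A × x ∈ P)
        cover x∈Cs with covered-by-pieces Cs∈C x∈Cs
        ... | inj₁ refl = inj₁ (x∈⁅x⁆ s)
        ... | inj₂ (inj₁ refl) = ⊥-elim (Cs∩Cs̄ x∈Cs s̄∈Cs̄)
        ... | inj₂ (inj₂ (P , P∈ , x∈P , P⊆Cs)) = inj₂ (P , ∈-filter⁺ (_⊆? Cs) P∈ P⊆Cs , x∈P)

      Cs̄≡ : Cs̄ ≡ ⁅ s̄ ⁆ ∪ ⋃ B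
      Cs̄≡ = ≡-∪-⋃ B (⁅⁆-⊆ s̄∈Cs̄) (λ P∈ → proj₂ (∈-filter⁻ (_⊆? Cs̄) {xs = rest} P∈)) cover
        where
        cover : ∀ {x} → x ∈ Cs̄ → x ∈ ⁅ s̄ ⁆ ⊎ ∃[ P ] (P ∈ₗ B × x ∈ P)
        cover x∈Cs̄ with covered-by-pieces Cs̄∈C x∈Cs̄
        ... | inj₁ refl = ⊥-elim (Cs∩Cs̄ s∈Cs x∈Cs̄)
        ... | inj₂ (inj₁ refl) = inj₁ (x∈⁅x⁆ s̄)
        ... | inj₂ (inj₂ (P , P∈ , x∈P , P⊆Cs̄)) =
          let P∈rest = ∈-filter⁺ (∁? (_⊆? Cs)) P∈ (λ P⊆Cs → Cs∩Cs̄ (P⊆Cs x∈P) x∈Cs̄)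
          in inj₂ (P , ∈-filter⁺ (_⊆? Cs̄) P∈rest P⊆Cs̄ , x∈P)

      C↭ : C ↭ Cs ∷ Cs̄ ∷ R
      C↭ = unique-same-members⇒↭ C-unique unique into out-of
        where
        unique : Unique (Cs ∷ Cs̄ ∷ R)
        unique = (Cs≢Cs̄ ∷ All.tabulate (λ P∈ Cs≡P → s∉C′ (proj₁ (∈R⁻ P∈)) (subst (s ∈_) Cs≡P s∈Cs)))
               ∷ (All.tabulate (λ P∈ Cs̄≡P → s̄∉C′ (proj₁ (∈R⁻ P∈)) (subst (s̄ ∈_) Cs̄≡P s̄∈Cs̄))
               ∷ Unique.filter⁺ _ (Unique.filter⁺ _ C′-unique))

        into : ∀ {G} → G ∈ₗ C → G ∈ₗ Cs ∷ Cs̄ ∷ R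
        into {G} G∈ = ≟ₛ-cases G Cs Cs̄ here (there ∘ here) λ G≢Cs G≢Cs̄ →
          let G∈rest = ∈-filter⁺ (∁? (_⊆? Cs)) (not-mates G∈ G≢Cs G≢Cs̄) (⊈-other G∈ Cs∈C G≢Cs)
          in there (there (∈-filter⁺ (∁? (_⊆? Cs̄)) G∈rest (⊈-other G∈ Cs̄∈C G≢Cs̄)))

        out-of : ∀ {G} → G ∈ₗ Cs ∷ Cs̄ ∷ R → G ∈ₗ C
        out-of (here refl) = Cs∈C
        out-of (there (here refl)) = Cs̄∈C
        out-of (there (there P∈)) with ∈R⁻ P∈
        ... | P∈C′ , P⊈Cs , P⊈Cs̄ = [ ⊥-elim ∘ P⊈Cs , [ ⊥-elim ∘ P⊈Cs̄ , (λ P∈C → P∈C) ] ] (pieces P∈C′)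

    module Joined (Cs≡Cs̄ : Cs ≡ Cs̄) where
      A R : List (Subset n)
      A = filter (_⊆? Cs) C′
      R = filter (∁? (_⊆? Cs)) C′

      s̄∈Cs : s̄ ∈ Cs
      s̄∈Cs = subst (s̄ ∈_) (≡.sym Cs≡Cs̄) s̄∈Cs̄

      Cs≡ : Cs ≡ (⁅ s ⁆ ∪ ⁅ s̄ ⁆) ∪ ⋃ A
      Cs≡ = ≡-∪-⋃ A (∪-lub (⁅⁆-⊆ s∈Cs) (⁅⁆-⊆ s̄∈Cs)) (λ P∈ → proj₂ (∈-filter⁻ (_⊆? Cs) {xs = C′} P∈)) cover
        where
        cover : ∀ {x} → x ∈ Cs → x ∈ ⁅ s ⁆ ∪ ⁅ s̄ ⁆ ⊎ ∃[ P ] (P ∈ₗ A × x ∈ P)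
        cover x∈Cs with covered-by-pieces Cs∈C x∈Cs
        ... | inj₁ refl = inj₁ (x∈p∪q⁺ (inj₁ (x∈⁅x⁆ s)))
        ... | inj₂ (inj₁ refl) = inj₁ (x∈p∪q⁺ (inj₂ (x∈⁅x⁆ s̄)))
        ... | inj₂ (inj₂ (P , P∈ , x∈P , P⊆Cs)) = inj₂ (P , ∈-filter⁺ (_⊆? Cs) P∈ P⊆Cs , x∈P)

      C↭ : C ↭ Cs ∷ R
      C↭ = unique-same-members⇒↭ C-unique unique into out-of
        where
        unique : Unique (Cs ∷ R)
        unique = All.tabulate (λ P∈ Cs≡P → s∉C′ (proj₁ (∈-filter⁻ (∁? (_⊆? Cs)) P∈)) (subst (s ∈_) Cs≡P s∈Cs))
               ∷ Unique.filter⁺ _ C′-unique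

        into : ∀ {G} → G ∈ₗ C → G ∈ₗ Cs ∷ R
        into {G} G∈ = decide (G ≟ₛ Cs)
          where
          decide : Dec (G ≡ Cs) → G ∈ₗ Cs ∷ R
          decide (yes G≡Cs) = here G≡Cs
          decide (no G≢Cs) = there (∈-filter⁺ (∁? (_⊆? Cs))
            (not-mates G∈ G≢Cs (λ G≡Cs̄ → G≢Cs (≡.trans G≡Cs̄ (≡.sym Cs≡Cs̄)))) (⊈-other G∈ Cs∈C G≢Cs))

        out-of : ∀ {G} → G ∈ₗ Cs ∷ R → G ∈ₗ C
        out-of (here refl) = Cs∈C
        out-of (there P∈) with ∈-filter⁻ (∁? (_⊆? Cs)) P∈
        ... | P∈C′ , P⊈Cs = [ ⊥-elim ∘ P⊈Cs , [ ⊥-elim ∘ P⊈Cs ∘ subst (_ ⊆_) (≡.sym Cs≡Cs̄) , (λ P∈C → P∈C) ] ]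
                              (pieces P∈C′)

    separated-clusters : Cs ≢ Cs̄ → ∃[ L ] (L ↭ C′ × ∃[ a ] ∃[ b ] (a ℕ.≤ b × b ℕ.≤ length L
                           × Cs ≡ ⁅ s ⁆ ∪ ⋃ (take a L) × Cs̄ ≡ ⁅ s̄ ⁆ ∪ ⋃ (take (b ∸ a) (drop a L))
                           × C ↭ Cs ∷ Cs̄ ∷ drop b L))
    separated-clusters Cs≢Cs̄ =
      let a≤b , b≤ , take-a , take-b∸a , drop-b = take-drop-blocks A B R
      in A ++ B ++ R , A++B++R↭C′ , length A , length A ℕ.+ length B , a≤b , b≤ ,
         subst (λ X → Cs ≡ ⁅ s ⁆ ∪ ⋃ X) (≡.sym take-a) Cs≡ ,
         subst (λ X → Cs̄ ≡ ⁅ s̄ ⁆ ∪ ⋃ X) (≡.sym take-b∸a) Cs̄≡ ,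
         subst (λ X → C ↭ Cs ∷ Cs̄ ∷ X) (≡.sym drop-b) C↭
      where open Separated Cs≢Cs̄

    joined-clusters : Cs ≡ Cs̄ → ∃[ L ] (L ↭ C′ × ∃[ b ] (b ℕ.≤ length L
                        × Cs ≡ (⁅ s ⁆ ∪ ⁅ s̄ ⁆) ∪ ⋃ (take b L) × C ↭ Cs ∷ drop b L))
    joined-clusters Cs≡Cs̄ =
      A ++ R , ↭-sym (↭-filter-∁ (_⊆? Cs) C′) , length A ,
      subst (length A ℕ.≤_) (≡.sym (List.length-++ A)) (ℕ.m≤m+n (length A) (length R)) ,
      subst (λ X → Cs ≡ (⁅ s ⁆ ∪ ⁅ s̄ ⁆) ∪ ⋃ X) (≡.sym (take-length-++ A R)) Cs≡ ,
      subst (λ X → C ↭ Cs ∷ X) (≡.sym (drop-length-++ A R)) C↭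
      where open Joined Cs≡Cs̄

open import Data.Nat using (_≤_)

theorem5p5 : ∀ {n} (M : Metric n) (pre post : List (Fin n × Fin n)) (s s̄ : Fin n)
    → ValidInstance M (pre ++ (s , s̄) ∷ post)
    → ∀ (i : ℕ) (C C' : Clustering n)
    → Gluttonous.StartOf M (pre ++ (s , s̄) ∷ post) i C
    → Gluttonous.StartOf M (pre ++ post) i C'
    → ∀ (k : ℕ) → Level (Metric.d M s s̄) k → i ≤ k
    → ∀ (Cs Cs̄ : Subset n) → Cs ∈ₗ C → s ∈ Cs → Cs̄ ∈ₗ C → s̄ ∈ Cs̄
    → (Cs ≢ Cs̄
        → (∃[ L ] (L ↭ C') × ∃[ a ] ∃[ b ] (a ≤ b × b ≤ length L
             × Cs ≡ ⁅ s ⁆ ∪ ⋃ (take a L)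
             × Cs̄ ≡ ⁅ s̄ ⁆ ∪ ⋃ (take (b ∸ a) (drop a L))
             × C ↭ Cs ∷ Cs̄ ∷ drop b L))
          × (∀ v → v ∈ Cs → Contracted.DistLe M C' s v (pow2 (suc i)))
          × (∀ v → v ∈ Cs̄ → Contracted.DistLe M C' s̄ v (pow2 (suc i))))
      × (Cs ≡ Cs̄
        → (∃[ L ] (L ↭ C') × ∃[ b ] (b ≤ length L
             × Cs ≡ (⁅ s ⁆ ∪ ⁅ s̄ ⁆) ∪ ⋃ (take b L)
             × C ↭ Cs ∷ drop b L))
          × Contracted.DistLe M C' s s̄ (pow2 (suc (suc i))))
theorem5p5 M pre post s s̄ valid i C C′ at-i at-i′ k level i≤k Cs₀ Cs̄₀ Cs₀∈C s∈Cs₀ Cs̄₀∈C s̄∈Cs̄₀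
  with Removal.clusters-of-mates M pre post s s̄ valid
         (Removal.invariant M pre post s s̄ valid level i≤k at-i at-i′) Cs₀∈C s∈Cs₀ Cs̄₀∈C s̄∈Cs̄₀
... | refl , refl =
  (λ Cs≢Cs̄ → separated-clusters Cs≢Cs̄ ,
             (λ v v∈ → toDistLe (proj₁ (separated Cs≢Cs̄) v∈)) ,
             (λ v v∈ → toDistLe (proj₂ (separated Cs≢Cs̄) v∈))) ,
  (λ Cs≡Cs̄ → joined-clusters Cs≡Cs̄ , toDistLe (joined Cs≡Cs̄))
  where
  open Removal M pre post s s̄ valid
  open Contraction M
  inv : Invariant i C C′
  inv = invariant level i≤k at-i at-i′
  open Invariant inv
  open Enumeration inv
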